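{- Let $N=(\Gamma,B)$ be a network. Fix a total ordering of $E$ and extend it to $E\cup\{e_0\}$ by taking $e_0$ to be minimal. Then $$\overline{BC}(M(N))=\{X\in BC(M(\Gamma)) : X \text{ contains no crossing of } N\}\subseteq BC(M(\Gamma)).$$
   Context: A network $N=(\Gamma,B)$ consists of a finite connected graph $\Gamma=(V,E)$ with no loops or multiple edges and a set $B\subsetneq V$ of at least 2 vertices (boundary nodes), no two of which are adjacent; vertices in $V\setminus B$ are interior. The Dirichlet matroid $M(N)$: fix an injective $u:B\to\mathbb{R}$ and a new symbol $e_0\notin E$; in $\mathbb{R}^{(V\setminus B)\cup\{0\}}$ assign to each edge $ij$ with $i,j$ interior the vector $\mathbf{e}_i-\mathbf{e}_j$, to each edge $ij$ with $i$ interior and $j\in B$ the vector $\mathbf{e}_i-u(j)\mathbf{e}_0$, and to $e_0$ the vector $\mathbf{e}_0$; $M(N)$ is the matroid of linear independence of these vectors on $E\cup\{e_0\}$. $M(\Gamma)$ is the graphic matroid of $\Gamma$ on $E$. A crossing of $N$ is a minimal simple path (edge set) in $\Gamma$ meeting 2 boundary nodes. For a matroid $M$ on a totally ordered ground set, a broken circuit is $C\setminus\min(C)$ for a circuit $C$; the broken circuit complex $BC(M)$ is the set of subsets of the ground set containing no broken circuit; the reduced broken circuit complex $\overline{BC}(M)$ is obtained from $BC(M)$ by deleting all sets containing the minimal element of the ground set. -}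

module Defs where

open import Level using (0ℓ)
open import Data.Nat using (ℕ; zero; suc; _≤_)
open import Data.Fin using (Fin; zero; suc; toℕ; inject₁; fromℕ; _≟_)
open import Data.Fin.Subset using (Subset; _∈_; _∉_; _⊆_)
open import Data.Vec using (lookup)
open import Data.Bool using (Bool; true; false; if_then_else_)
open import Data.Product using (_×_; _,_; proj₁; proj₂; Σ; ∃; ∃-syntax)
open import Data.Sum using (_⊎_)
open import Relation.Nullary using (¬_)
open import Relation.Nullary.Decidable using (⌊_⌋)
open import Relation.Binary.PropositionalEquality using (_≡_; _≢_)
open import Algebra.Bundles using (CommutativeRing)
open import Data.Fin.Permutation using (Permutation; _⟨$⟩ʳ_)
open import Function.Definitions using (Injective)

-- Graphs: vertex set Fin n, edge set Fin m, each edge given by its two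
-- endpoints (as an ordered pair; orientation is irrelevant).

module _ {n m : ℕ} (ends : Fin m → Fin n × Fin n) where

  Joins : Fin m → Fin n → Fin n → Set
  Joins e a b = (ends e ≡ (a , b)) ⊎ (ends e ≡ (b , a))

  Adjacent : Fin n → Fin n → Set
  Adjacent a b = ∃[ e ] Joins e a b

  SimpleGraph : Set
  SimpleGraph = (∀ e → proj₁ (ends e) ≢ proj₂ (ends e))
              × (∀ e e′ a b → Joins e a b → Joins e′ a b → e ≡ e′)

  Connected : Set
  Connected = ∀ a b → ∃[ k ] Σ (Fin (suc k) → Fin n) λ vs →
                vs zero ≡ a × vs (fromℕ k) ≡ b
                × (∀ (i : Fin k) → Adjacent (vs (inject₁ i)) (vs (suc i)))

  record Path (k : ℕ) : Set where
    field
      vs     : Fin (suc k) → Fin n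
      vs-inj : Injective _≡_ _≡_ vs
      es     : Fin k → Fin m
      joins  : ∀ i → Joins (es i) (vs (inject₁ i)) (vs (suc i))

  PathEdgeSet : ∀ {k} → Path k → Subset m → Set
  PathEdgeSet p X = ∀ e → (e ∈ X → ∃[ i ] Path.es p i ≡ e)
                        × (∃[ i ] Path.es p i ≡ e → e ∈ X)

  MeetsTwo : Subset n → ∀ {k} → Path k → Set
  MeetsTwo B p = ∃[ i ] ∃[ j ] i ≢ j × Path.vs p i ∈ B × Path.vs p j ∈ B

  PathSetMeetingTwo : Subset n → Subset m → Set
  PathSetMeetingTwo B X = ∃[ k ] Σ (Path k) λ p → PathEdgeSet p X × MeetsTwo B p

  Crossing : Subset n → Subset m → Set
  Crossing B X = PathSetMeetingTwo B X
               × (∀ Y → Y ⊆ X → Y ≢ X → ¬ PathSetMeetingTwo B Y)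

  ContainsCrossing : Subset n → Subset m → Set
  ContainsCrossing B X = ∃[ P ] Crossing B P × P ⊆ X

  -- A cycle of length k+3: distinct vertices vs 0, …, vs (k+2),
  -- edges es i joining vs i and vs (i+1), and closing edge ec joining
  -- vs (k+2) and vs 0.
  record Cycle (k : ℕ) : Set where
    field
      vs     : Fin (suc (suc (suc k))) → Fin n
      vs-inj : Injective _≡_ _≡_ vs
      es     : Fin (suc (suc k)) → Fin m
      joins  : ∀ i → Joins (es i) (vs (inject₁ i)) (vs (suc i))
      ec     : Fin m
      closes : Joins ec (vs (fromℕ (suc (suc k)))) (vs zero)

  -- circuits of the graphic matroid M(Γ): edge sets of cycles
  GraphicCircuit : Subset m → Set
  GraphicCircuit X = ∃[ k ] Σ (Cycle k) λ c → ∀ e →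
      (e ∈ X → (∃[ i ] Cycle.es c i ≡ e) ⊎ Cycle.ec c ≡ e)
    × ((∃[ i ] Cycle.es c i ≡ e) ⊎ Cycle.ec c ≡ e → e ∈ X)

  IsNetwork : Subset n → Set
  IsNetwork B = SimpleGraph × Connected
              × (∃[ v ] v ∉ B)
              × (∃[ b ] ∃[ b′ ] b ≢ b′ × b ∈ B × b′ ∈ B)
              × (∀ a b → a ∈ B → b ∈ B → ¬ Adjacent a b)

IsField : CommutativeRing 0ℓ 0ℓ → Set
IsField R = ¬ (1# ≈ 0#) × (∀ x → ¬ (x ≈ 0#) → ∃[ y ] x * y ≈ 1#)
  where open CommutativeRing R

module Linear (R : CommutativeRing 0ℓ 0ℓ) where
  open CommutativeRing R using (Carrier; _≈_; _+_; _*_; _-_; 0#; 1#)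

  sumF : ∀ {k} → (Fin k → Carrier) → Carrier
  sumF {zero}  f = 0#
  sumF {suc k} f = f zero + sumF (λ i → f (suc i))

  LinIndep : ∀ {k d} → (Fin k → Fin d → Carrier) → Subset k → Set
  LinIndep {k} {d} vec X =
    ∀ (c : Fin k → Carrier) → (∀ i → i ∉ X → c i ≈ 0#)
      → (∀ (t : Fin d) → sumF (λ i → c i * vec i t) ≈ 0#)
      → ∀ i → c i ≈ 0#

  LinCircuit : ∀ {k d} → (Fin k → Fin d → Carrier) → Subset k → Set
  LinCircuit vec C = ¬ LinIndep vec C
                   × (∀ Y → Y ⊆ C → Y ≢ C → LinIndep vec Y)

  InjectiveOn : ∀ {n} → Subset n → (Fin n → Carrier) → Set
  InjectiveOn B u = ∀ a b → a ∈ B → b ∈ B → u a ≈ u b → a ≡ b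

  -- coordinates: zero is the coordinate 0, suc v is vertex v
  -- (coordinates of boundary vertices are never used)
  δ : ∀ {d} → Fin d → Fin d → Carrier
  δ i j = if ⌊ i ≟ j ⌋ then 1# else 0#

  edgeVec : ∀ {n} → Subset n → (Fin n → Carrier) → Fin n → Fin n
          → Fin (suc n) → Carrier
  edgeVec B u a b t with lookup B a | lookup B b
  ... | false | false = δ (suc a) t - δ (suc b) t
  ... | false | true  = δ (suc a) t - u b * δ zero t
  ... | true  | false = δ (suc b) t - u a * δ zero t
  ... | true  | true  = 0#   -- impossible in a network

  -- the Dirichlet vectors on E ∪ {e₀}; zero is e₀, suc e is edge e
  dirichletVec : ∀ {n m} → (Fin m → Fin n × Fin n) → Subset n
               → (Fin n → Carrier) → Fin (suc m) → Fin (suc n) → Carrier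
  dirichletVec ends B u zero    = δ zero
  dirichletVec ends B u (suc e) = edgeVec B u (proj₁ (ends e)) (proj₂ (ends e))

  DirichletCircuit : ∀ {n m} → (Fin m → Fin n × Fin n) → Subset n
                   → (Fin n → Carrier) → Subset (suc m) → Set
  DirichletCircuit ends B u = LinCircuit (dirichletVec ends B u)

-- Broken circuit complexes, w.r.t. a total order given by an injective
-- rank function into ℕ and a circuit predicate.

ContainsBrokenCircuit : ∀ {k} → (Fin k → ℕ) → (Subset k → Set) → Subset k → Set
ContainsBrokenCircuit rank Circ X =
  ∃[ C ] Circ C × ∃[ c ] c ∈ C × (∀ d → d ∈ C → rank c ≤ rank d)
                  × (∀ d → d ∈ C → d ≢ c → d ∈ X)

InBC : ∀ {k} → (Fin k → ℕ) → (Subset k → Set) → Subset k → Set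
InBC rank Circ X = ¬ ContainsBrokenCircuit rank Circ X

InReducedBC : ∀ {k} → (Fin k → ℕ) → (Subset k → Set) → Fin k → Subset k → Set
InReducedBC rank Circ z X = InBC rank Circ X × z ∉ X

-- total order on E from a permutation σ, e ↦ position σ(e);
-- extended to E ∪ {e₀} (e₀ = zero) with e₀ minimal
rankE : ∀ {m} → Permutation m m → Fin m → ℕ
rankE σ e = toℕ (σ ⟨$⟩ʳ e)

rank0 : ∀ {m} → Permutation m m → Fin (suc m) → ℕ
rank0 σ zero    = 0
rank0 σ (suc e) = suc (rankE σ e)

module Submission where

-- Dependencies are tested with functionals.  A potential has weight ℓ₀ on
-- e₀ and takes the value u(b)·ℓ₀ at each boundary node b, so it vanishes
-- on an edge vector iff it agrees at the two ends.  No element of a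
-- circuit is isolated by a functional (zero on the others, not on it);
-- a dependent set is a circuit if each i is isolated by some functional
-- from all elements but any one other.  Forward: for a boundary path P,
-- {e₀} ∪ E(P) is a circuit, and so is E(Z) for a cycle Z meeting B at most
-- once; a cycle meeting B twice contains a boundary path avoiding any
-- edge.  Backward: for a circuit C with minimum c and C ∖ c in the set, a
-- potential constant on the components of C ∖ c isolates c (no crossing:
-- a component meets B at most once; no broken circuit of M(Γ): the ends
-- of c lie in different components).

open import Defs
open import Level using (0ℓ)
open import Data.Nat using (ℕ; suc)
open import Data.Fin using (Fin; zero)
open import Data.Fin.Subset using (Subset; _∉_)
open import Data.Vec using (tail; _∷_)
open import Data.Product using (_×_; _,_)
open import Relation.Nullary using (¬_)
open import Algebra.Bundles using (CommutativeRing)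
open import Data.Fin.Permutation using (Permutation)
open import Function.Bundles using (_⇔_; mk⇔)

-- Finite search, subsets, and minimal sets.
module FiniteSets where
  open import Data.Nat using (ℕ; zero; suc; _≤_; _<_; _≟_)
  open import Data.Nat.Properties using (m≤n⇒m≤1+n; ≤-refl; m<1+n⇒m<n∨m≡n; ≤-trans; ≤-pred)
  open import Data.Fin using (Fin; zero; suc)
  import Data.Fin.Properties as Finₚ
  open import Data.Fin.Subset using (Subset; _∈_; _∉_; _⊆_; ⁅_⁆; ∣_∣) renaming (_-_ to _∖_)
  import Data.Fin.Subset.Properties as Subsetₚ
  open import Data.Product using (_×_; _,_; ∃)
  open import Data.Sum using (_⊎_; inj₁; inj₂)
  open import Data.Empty using (⊥-elim)
  open import Relation.Nullary using (¬_; Dec; yes; no)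
  open import Relation.Nullary.Decidable using (⌊_⌋; _×-dec_; ¬?)
  import Data.Bool.Properties as Boolₚ
  open import Data.Bool using (true)
  open import Data.Vec using (tabulate; _∷_; there)
  import Data.Vec.Properties as Vecₚ
  open import Relation.Binary.PropositionalEquality using (_≡_; _≢_; refl; sym; trans; subst)

  least : {P : ℕ → Set} → (∀ i → Dec (P i)) → ∀ k →
          (∃ λ i → i < k × P i × (∀ j → j < i → ¬ P j)) ⊎ (∀ i → i < k → ¬ P i)
  least P? zero = inj₂ (λ i ())
  least P? (suc k) with least P? k
  ... | inj₁ (i , i<k , Pi , below) = inj₁ (i , m≤n⇒m≤1+n i<k , Pi , below)
  ... | inj₂ none with P? k
  ...   | yes Pk = inj₁ (k , ≤-refl , Pk , none)
  ...   | no ¬Pk = inj₂ (λ i i<1+k → up-to-k (m<1+n⇒m<n∨m≡n i<1+k))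
    where
    up-to-k : ∀ {i} → i < k ⊎ i ≡ k → ¬ _
    up-to-k (inj₁ i<k) = none _ i<k
    up-to-k (inj₂ refl) = ¬Pk

  two-or-at-most-one : {P : ℕ → Set} → (∀ i → Dec (P i)) → ∀ K →
    (∃ λ p₁ → ∃ λ p₂ → p₁ < K × p₂ < K × p₁ ≢ p₂ × P p₁ × P p₂) ⊎
    (∀ j j′ → j < K → j′ < K → P j → P j′ → j ≡ j′)
  two-or-at-most-one P? K with least P? K
  ... | inj₂ none = inj₂ (λ j _ j< _ Pj _ → ⊥-elim (none j j< Pj))
  ... | inj₁ (p , p< , Pp , _) with least (λ q → ¬? (q ≟ p) ×-dec P? q) K
  ...   | inj₁ (q , q< , (q≢p , Pq) , _) = inj₁ (p , q , p< , q< , (λ p≡q → q≢p (sym p≡q)) , Pp , Pq)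
  ...   | inj₂ no-other = inj₂ (λ j j′ j< j′< Pj Pj′ → trans (only-p j j< Pj) (sym (only-p j′ j′< Pj′)))
    where
    only-p : ∀ j → j < K → _ → j ≡ p
    only-p j j< Pj with j ≟ p
    ... | yes j≡p = j≡p
    ... | no j≢p = ⊥-elim (no-other j j< (j≢p , Pj))

  select : ∀ {k} {P : Fin k → Set} → (∀ x → Dec (P x)) → Subset k
  select P? = tabulate (λ x → ⌊ P? x ⌋)

  select-sound : ∀ {k} {P : Fin k → Set} (P? : ∀ x → Dec (P x)) x → x ∈ select P? → P x
  select-sound P? x x∈ with P? x | trans (sym (Vecₚ.lookup∘tabulate (λ x → ⌊ P? x ⌋) x)) (Vecₚ.[]=⇒lookup x∈)
  ... | yes Px | _ = Px
  ... | no _ | ()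

  select-complete : ∀ {k} {P : Fin k → Set} (P? : ∀ x → Dec (P x)) x → P x → x ∈ select P?
  select-complete P? x Px = Vecₚ.lookup⇒[]= x (select P?) (trans (Vecₚ.lookup∘tabulate (λ x → ⌊ P? x ⌋) x) (is-yes (P? x)))
    where
    is-yes : ∀ (P?x : Dec _) → ⌊ P?x ⌋ ≡ true
    is-yes (yes _) = refl
    is-yes (no ¬Px) = ⊥-elim (¬Px Px)

  _≟S_ : ∀ {k} (p q : Subset k) → Dec (p ≡ q)
  _≟S_ = Vecₚ.≡-dec Boolₚ._≟_

  singleton-⊆ : ∀ {k} {x : Fin k} {T : Subset k} → x ∈ T → ⁅ x ⁆ ⊆ T
  singleton-⊆ {x = x} {T} x∈T y∈⁅x⁆ = subst (_∈ T) (sym (Subsetₚ.x∈⁅y⁆⇒x≡y _ y∈⁅x⁆)) x∈T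

  missing-element : ∀ {k} {C Y : Subset k} → Y ⊆ C → Y ≢ C → ∃ λ d → d ∈ C × d ∉ Y
  missing-element {C = C} {Y} Y⊆C Y≢C with Finₚ.any? (λ d → (d Subsetₚ.∈? C) ×-dec ¬? (d Subsetₚ.∈? Y))
  ... | yes witness = witness
  ... | no none = ⊥-elim (Y≢C (Subsetₚ.⊆-antisym Y⊆C C⊆Y))
    where
    C⊆Y : C ⊆ Y
    C⊆Y {d} d∈C with d Subsetₚ.∈? Y
    ... | yes d∈Y = d∈Y
    ... | no d∉Y = ⊥-elim (none (d , d∈C , d∉Y))

  remove-proper : ∀ {k} {C : Subset k} {c} → c ∈ C → (C ∖ c) ⊆ C × (C ∖ c) ≢ C
  remove-proper {C = C} {c} c∈C with Subsetₚ.x∈p⇒p-x⊂p c∈C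
  ... | C∖c⊆C , _ , e∈C , e∉C∖c = C∖c⊆C , λ C∖c≡C → e∉C∖c (subst (_ ∈_) (sym C∖c≡C) e∈C)

  ∈-removal : ∀ {k} {C : Subset k} {d j} → j ∈ C ∖ d → j ∈ C × j ≢ d
  ∈-removal {C = C} {d} j∈C∖d = Subsetₚ.p─q⊆p C ⁅ d ⁆ j∈C∖d , λ { refl → removed C d j∈C∖d }
    where
    removed : ∀ {k} (C : Subset k) x → x ∉ C ∖ x
    removed (_ ∷ C) zero ()
    removed (_ ∷ C) (suc x) (there x∈C∖x) = removed C x x∈C∖x

  outside-removal : ∀ {k} {C : Subset k} {c j} → j ∉ C ∖ c → j ∉ C ⊎ j ≡ c
  outside-removal {c = c} {j} j∉C∖c with j Finₚ.≟ c
  ... | yes j≡c = inj₂ j≡c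
  ... | no j≢c = inj₁ (λ j∈C → j∉C∖c (Subsetₚ.x∈p∧x≢y⇒x∈p-y j∈C j≢c))

  proper-smaller : ∀ {k} {X Y : Subset k} → Y ⊆ X → Y ≢ X → ∣ Y ∣ < ∣ X ∣
  proper-smaller Y⊆X Y≢X = Subsetₚ.p⊂q⇒∣p∣<∣q∣ (Y⊆X , missing-element Y⊆X Y≢X)

  MinimalWith : ∀ {k} → (Subset k → Set) → Subset k → Set
  MinimalWith Q P = Q P × (∀ Y → Y ⊆ P → Y ≢ P → ¬ Q Y)

  -- Every set with property Q contains a minimal one.  Q need not be
  -- decidable, so this holds only up to double negation; it is used to
  -- derive a contradiction, where that suffices.
  minimal-subset : ∀ {k} (Q : Subset k → Set) (X : Subset k) → Q X →
                   ¬ ¬ (∃ λ P → MinimalWith Q P × P ⊆ X)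
  minimal-subset {k} Q X qX = below ∣ X ∣ X ≤-refl qX
    where
    Below : Subset k → Set
    Below X = ∃ λ P → MinimalWith Q P × P ⊆ X

    excluded-middle : ∀ {A : Set} → ¬ ¬ (A ⊎ ¬ A)
    excluded-middle k = k (inj₂ (λ a → k (inj₁ a)))

    below : ∀ bound X → ∣ X ∣ ≤ bound → Q X → ¬ ¬ Below X
    below-smaller : ∀ bound Y → ∣ Y ∣ < bound → Q Y → ¬ ¬ Below Y

    below bound X size qX no-minimal = excluded-middle {A = ∃ λ Y → Y ⊆ X × Y ≢ X × Q Y} λ
      { (inj₁ (Y , Y⊆X , Y≢X , qY)) →
          below-smaller bound Y (≤-trans (proper-smaller Y⊆X Y≢X) size) qY
            (λ { (P , minP , P⊆Y) → no-minimal (P , minP , (λ x∈P → Y⊆X (P⊆Y x∈P))) })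
      ; (inj₂ none) →
          no-minimal (X , (qX , λ Y Y⊆X Y≢X qY → none (Y , Y⊆X , Y≢X , qY)) , (λ x∈X → x∈X)) }
    below-smaller (suc b) Y size qY = below b Y (≤-pred size) qY

  subst₃ : ∀ {A B C : Set} (P : A → B → C → Set) {a a' b b' c c'} → a ≡ a' → b ≡ b' → c ≡ c' → P a b c → P a' b' c'
  subst₃ P refl refl refl p = p

-- Field arithmetic, finite sums, and functionals detecting circuits.
module LinearAlgebra where
  open FiniteSets

  open import Data.Nat using (ℕ; zero; suc)
  open import Data.Fin using (Fin; zero; suc; toℕ; _≟_)
  open import Data.Fin.Subset using (Subset; _∈_; _∉_; _⊆_) renaming (_-_ to _∖_)
  import Data.Fin.Subset.Properties as Subsetₚ
  open import Data.Bool using (Bool; true; false; not)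
  open import Data.Product using (_×_; _,_; proj₁; proj₂; ∃)
  open import Data.Empty using (⊥-elim)
  open import Data.Sum using (inj₁; inj₂)
  open import Relation.Nullary using (¬_; yes; no)
  open import Relation.Binary.PropositionalEquality as ≡ using (_≡_; _≢_)
  import Data.Fin.Properties as Finₚ

  module FieldFacts (R : CommutativeRing 0ℓ 0ℓ) (isField : IsField R) where
    open CommutativeRing R public
      hiding (zero)
      renaming (refl to ≈-refl; sym to ≈-sym; trans to ≈-trans; reflexive to ≈-reflexive)
    open import Algebra.Properties.Ring ring public
      using (x∙y⁻¹≈ε⇒x≈y; x≈y⇒x∙y⁻¹≈ε; ⁻¹-anti-homo‿-; -1*x≈-x; -‿involutive; -0#≈0#;
             -‿distribˡ-*; -‿distribʳ-*)
    open import Algebra.Properties.CommutativeSemigroup *-commutativeSemigroup public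
      using (x∙yz≈y∙xz)
    open import Algebra.Properties.Semiring.Sum semiring
      using (sum; sum-cong-≋; sum-cong-≗; sum-replicate-zero; ∑-comm; ∑-distrib-+;
             *-distribˡ-sum)
    open Linear R public using (sumF; δ)
    open import Relation.Binary.Reasoning.Setoid setoid public

    1≉0 : 1# ≉ 0#
    1≉0 = proj₁ isField

    cancelʳ : ∀ {a b} → a ≉ 0# → b * a ≈ 0# → b ≈ 0#
    cancelʳ {a} {b} a≉0 ba≈0 with proj₂ isField a a≉0
    ... | a⁻¹ , aa⁻¹≈1 = begin
      b                ≈⟨ *-identityʳ b ⟨
      b * 1#           ≈⟨ *-congˡ aa⁻¹≈1 ⟨
      b * (a * a⁻¹)    ≈⟨ *-assoc b a a⁻¹ ⟨
      (b * a) * a⁻¹    ≈⟨ *-congʳ ba≈0 ⟩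
      0# * a⁻¹         ≈⟨ zeroˡ a⁻¹ ⟩
      0# ∎

    *-nonzero : ∀ {a b} → a ≉ 0# → b ≉ 0# → a * b ≉ 0#
    *-nonzero a≉0 b≉0 ab≈0 = a≉0 (cancelʳ b≉0 ab≈0)

    sign : Bool → Carrier
    sign true  = 1#
    sign false = - 1#

    sign≉0 : ∀ s → sign s ≉ 0#
    sign≉0 true  = 1≉0
    sign≉0 false h = 1≉0 (begin
      1#         ≈⟨ -‿involutive 1# ⟨
      - - 1#     ≈⟨ -‿cong h ⟩
      - 0#       ≈⟨ -0#≈0# ⟩
      0# ∎)

    sign-not : ∀ s x → sign (not s) * x ≈ - (sign s * x)
    sign-not true  x = ≈-sym (-‿distribˡ-* 1# x)
    sign-not false x = begin
      1# * x           ≈⟨ *-congʳ (-‿involutive 1#) ⟨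
      - - 1# * x       ≈⟨ -‿distribˡ-* (- 1#) x ⟨
      - (- 1# * x) ∎

    sign² : ∀ s → sign s * sign s ≈ 1#
    sign² true  = *-identityˡ 1#
    sign² false = ≈-trans (-1*x≈-x (- 1#)) (-‿involutive 1#)

    sumF≡sum : ∀ {k} (f : Fin k → Carrier) → sumF f ≡ sum f
    sumF≡sum {zero} f = ≡.refl
    sumF≡sum {suc k}  f = ≡.cong (f zero +_) (sumF≡sum (λ i → f (suc i)))

    sumF-cong : ∀ {k} {f g : Fin k → Carrier} → (∀ i → f i ≈ g i) → sumF f ≈ sumF g
    sumF-cong {f = f} {g} f≈g = begin
      sumF f  ≡⟨ sumF≡sum f ⟩
      sum f   ≈⟨ sum-cong-≋ f≈g ⟩
      sum g   ≡⟨ sumF≡sum g ⟨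
      sumF g  ∎

    sumF-zero : ∀ {k} {f : Fin k → Carrier} → (∀ i → f i ≈ 0#) → sumF f ≈ 0#
    sumF-zero {k} {f} f≈0 = begin
      sumF f                    ≈⟨ sumF-cong f≈0 ⟩
      sumF {k} (λ _ → 0#)       ≡⟨ sumF≡sum {k} (λ _ → 0#) ⟩
      sum {k} (λ _ → 0#)        ≈⟨ sum-replicate-zero k ⟩
      0#                        ∎

    sumF-+ : ∀ {k} (f g : Fin k → Carrier) → sumF (λ i → f i + g i) ≈ sumF f + sumF g
    sumF-+ f g = begin
      sumF (λ i → f i + g i)  ≡⟨ sumF≡sum (λ i → f i + g i) ⟩
      sum (λ i → f i + g i)   ≈⟨ ∑-distrib-+ f g ⟩
      sum f + sum g           ≡⟨ ≡.cong₂ _+_ (sumF≡sum f) (sumF≡sum g) ⟨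
      sumF f + sumF g         ∎

    sumF-*ˡ : ∀ {k} c (f : Fin k → Carrier) → sumF (λ i → c * f i) ≈ c * sumF f
    sumF-*ˡ c f = begin
      sumF (λ i → c * f i)  ≡⟨ sumF≡sum (λ i → c * f i) ⟩
      sum (λ i → c * f i)   ≈⟨ *-distribˡ-sum c f ⟨
      c * sum f             ≡⟨ ≡.cong (c *_) (sumF≡sum f) ⟨
      c * sumF f            ∎

    sumF-*ʳ : ∀ {k} (f : Fin k → Carrier) c → sumF f * c ≈ sumF (λ i → f i * c)
    sumF-*ʳ f c = begin
      sumF f * c             ≈⟨ *-comm _ c ⟩
      c * sumF f             ≈⟨ sumF-*ˡ c f ⟨
      sumF (λ i → c * f i)   ≈⟨ sumF-cong (λ i → *-comm c (f i)) ⟩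
      sumF (λ i → f i * c)   ∎

    sumF-neg : ∀ {k} (f : Fin k → Carrier) → sumF (λ i → - f i) ≈ - sumF f
    sumF-neg f = begin
      sumF (λ i → - f i)        ≈⟨ sumF-cong (λ i → -1*x≈-x (f i)) ⟨
      sumF (λ i → - 1# * f i)   ≈⟨ sumF-*ˡ (- 1#) f ⟩
      - 1# * sumF f             ≈⟨ -1*x≈-x _ ⟩
      - sumF f                  ∎

    sumF-comm : ∀ {k l} (h : Fin k → Fin l → Carrier) →
      sumF (λ i → sumF (λ j → h i j)) ≈ sumF (λ j → sumF (λ i → h i j))
    sumF-comm h = begin
      sumF (λ i → sumF (h i))          ≡⟨ double h ⟩
      sum (λ i → sum (h i))            ≈⟨ ∑-comm h ⟩
      sum (λ j → sum (λ i → h i j))    ≡⟨ double (λ j i → h i j) ⟨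
      sumF (λ j → sumF (λ i → h i j))  ∎
      where
      double : ∀ {k l} (g : Fin k → Fin l → Carrier) →
               sumF (λ i → sumF (g i)) ≡ sum (λ i → sum (g i))
      double g = ≡.trans (sumF≡sum (λ i → sumF (g i))) (sum-cong-≗ (λ i → sumF≡sum (g i)))

    sumF-single : ∀ {k} (f : Fin k → Carrier) (d : Fin k) → (∀ i → i ≢ d → f i ≈ 0#) → sumF f ≈ f d
    sumF-single f zero f≈0 = begin
      f zero + sumF (λ i → f (suc i))  ≈⟨ +-congˡ (sumF-zero (λ i → f≈0 (suc i) (λ ()))) ⟩
      f zero + 0#                      ≈⟨ +-identityʳ _ ⟩
      f zero ∎
    sumF-single f (suc d) f≈0 = begin
      f zero + sumF (λ i → f (suc i))  ≈⟨ +-cong (f≈0 zero (λ ())) (sumF-single (λ i → f (suc i)) d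
                                            (λ i i≢d → f≈0 (suc i) (λ eq → i≢d (Finₚ.suc-injective eq)))) ⟩
      0# + f (suc d)                   ≈⟨ +-identityˡ _ ⟩
      f (suc d) ∎

    telescope : ∀ a b c → (a - b) + (b - c) ≈ a - c
    telescope a b c = begin
      (a - b) + (b - c)      ≈⟨ +-assoc a (- b) (b - c) ⟩
      a + (- b + (b - c))    ≈⟨ +-congˡ (+-assoc (- b) b (- c)) ⟨
      a + ((- b + b) - c)    ≈⟨ +-congˡ (+-congʳ (-‿inverseˡ b)) ⟩
      a + (0# - c)           ≈⟨ +-congˡ (+-identityˡ (- c)) ⟩
      a - c ∎

    sumF-telescope : ∀ (k : ℕ) (g : ℕ → Carrier) → sumF {k} (λ i → g (toℕ i) - g (suc (toℕ i))) ≈ g 0 - g k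
    sumF-telescope zero g = ≈-sym (-‿inverseʳ (g 0))
    sumF-telescope (suc k) g = begin
      (g 0 - g 1) + sumF {k} (λ i → g (suc (toℕ i)) - g (suc (suc (toℕ i))))
        ≈⟨ +-congˡ (sumF-telescope k (λ j → g (suc j))) ⟩
      (g 0 - g 1) + (g 1 - g (suc k))
        ≈⟨ telescope (g 0) (g 1) (g (suc k)) ⟩
      g 0 - g (suc k) ∎

    δ-diag : ∀ {d} (i : Fin d) → δ i i ≈ 1#
    δ-diag i with i ≟ i
    ... | yes _ = ≈-refl
    ... | no i≢i = ⊥-elim (i≢i ≡.refl)

    δ-off : ∀ {d} {i j : Fin d} → i ≢ j → δ i j ≈ 0#
    δ-off {i = i} {j} i≢j with i ≟ j
    ... | yes i≡j = ⊥-elim (i≢j i≡j)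
    ... | no _ = ≈-refl

    sumF-δ : ∀ {d} (L : Fin d → Carrier) (j : Fin d) → sumF (λ t → L t * δ j t) ≈ L j
    sumF-δ L j = begin
      sumF (λ t → L t * δ j t)  ≈⟨ sumF-single _ j (λ t t≢j → ≈-trans (*-congˡ (δ-off (λ e → t≢j (≡.sym e)))) (zeroʳ _)) ⟩
      L j * δ j j               ≈⟨ *-congˡ (δ-diag j) ⟩
      L j * 1#                  ≈⟨ *-identityʳ _ ⟩
      L j ∎

    indicator : Bool → Carrier
    indicator true  = 1#
    indicator false = 0#

    indicator-injective : ∀ {a b} → indicator a ≈ indicator b → a ≡ b
    indicator-injective {false} {false} _ = ≡.refl
    indicator-injective {false} {true}  0≈1 = ⊥-elim (1≉0 (≈-sym 0≈1))
    indicator-injective {true}  {false} 1≈0 = ⊥-elim (1≉0 1≈0)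
    indicator-injective {true}  {true}  _ = ≡.refl

    Functional : ℕ → Set
    Functional d = Fin d → Carrier

    infix 8 _·_
    _·_ : ∀ {d} → Functional d → (Fin d → Carrier) → Carrier
    L · w = sumF (λ t → L t * w t)

    ·-cong : ∀ {d} (L : Functional d) {w w′} → (∀ t → w t ≈ w′ t) → L · w ≈ L · w′
    ·-cong L w≈w′ = sumF-cong (λ t → *-congˡ (w≈w′ t))

    -- Linearity, in the form needed for edge vectors c (w₁ - w₂).
    ·-scaled-difference : ∀ {d} (L : Functional d) c w₁ w₂ →
                          L · (λ t → c * (w₁ t - w₂ t)) ≈ c * (L · w₁ - L · w₂)
    ·-scaled-difference L c w₁ w₂ = begin
      sumF (λ t → L t * (c * (w₁ t - w₂ t)))
        ≈⟨ sumF-cong (λ t → ≈-trans (x∙yz≈y∙xz (L t) c _) (*-congˡ (distrib-diff (L t)))) ⟩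
      sumF (λ t → c * (L t * w₁ t + - (L t * w₂ t)))
        ≈⟨ sumF-*ˡ c (λ t → L t * w₁ t + - (L t * w₂ t)) ⟩
      c * sumF (λ t → L t * w₁ t + - (L t * w₂ t))
        ≈⟨ *-congˡ (≈-trans (sumF-+ (λ t → L t * w₁ t) (λ t → - (L t * w₂ t))) (+-congˡ (sumF-neg (λ t → L t * w₂ t)))) ⟩
      c * (L · w₁ - L · w₂) ∎
      where
      distrib-diff : ∀ l {t} → l * (w₁ t - w₂ t) ≈ l * w₁ t + - (l * w₂ t)
      distrib-diff l {t} = ≈-trans (distribˡ l (w₁ t) (- w₂ t)) (+-congˡ (≈-sym (-‿distribʳ-* l (w₂ t))))

  module Separation (R : CommutativeRing 0ℓ 0ℓ) (isField : IsField R)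
                    {k d : ℕ} (vec : Fin k → Fin d → CommutativeRing.Carrier R) where
    open FieldFacts R isField
    open Linear R using (LinIndep; LinCircuit)

    IsDependency : (Fin k → Carrier) → Set
    IsDependency x = ∀ t → sumF (λ i → x i * vec i t) ≈ 0#

    dependency-annihilated : ∀ L x → IsDependency x → sumF (λ i → x i * L · vec i) ≈ 0#
    dependency-annihilated L x dep = begin
      sumF (λ i → x i * sumF (λ t → L t * vec i t))
        ≈⟨ sumF-cong (λ i → ≈-trans (≈-sym (sumF-*ˡ (x i) (λ t → L t * vec i t)))
           (sumF-cong (λ t → x∙yz≈y∙xz (x i) (L t) (vec i t)))) ⟩
      sumF (λ i → sumF (λ t → L t * (x i * vec i t)))
        ≈⟨ sumF-comm (λ i t → L t * (x i * vec i t)) ⟩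
      sumF (λ t → sumF (λ i → L t * (x i * vec i t)))
        ≈⟨ sumF-zero (λ t → ≈-trans (sumF-*ˡ (L t) (λ i → x i * vec i t)) (≈-trans (*-congˡ (dep t)) (zeroʳ (L t)))) ⟩
      0# ∎

    Isolates : Functional d → Subset k → Fin k → Set
    Isolates L S i = (∀ j → j ∈ S → j ≢ i → L · vec j ≈ 0#) × L · vec i ≉ 0#

    isolated-coefficient : ∀ {S L i} x → IsDependency x → (∀ j → j ∉ S → x j ≈ 0#) →
                           Isolates L S i → x i ≈ 0#
    isolated-coefficient {S} {L} {i} x dep supported (vanishes , L·i≉0) =
      cancelʳ L·i≉0 (≈-trans (≈-sym (sumF-single _ i other-terms)) (dependency-annihilated L x dep))
      where
      other-terms : ∀ j → j ≢ i → x j * L · vec j ≈ 0#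
      other-terms j j≢i with j Subsetₚ.∈? S
      ... | yes j∈S = ≈-trans (*-congˡ (vanishes j j∈S j≢i)) (zeroʳ (x j))
      ... | no j∉S = ≈-trans (*-congʳ (supported j j∉S)) (zeroˡ _)

    proper-subsets-independent :
      ∀ C → (∀ d i → d ∈ C → i ∈ C → i ≢ d → ∃ λ L → Isolates L (C ∖ d) i) →
      ∀ Y → Y ⊆ C → Y ≢ C → LinIndep vec Y
    proper-subsets-independent C isolate Y Y⊆C Y≢C x supported dep i
      with missing-element Y⊆C Y≢C
    ... | d , d∈C , d∉Y with i Subsetₚ.∈? C | i ≟ d
    ...   | no i∉C | _      = supported i (λ i∈Y → i∉C (Y⊆C i∈Y))
    ...   | yes _  | yes ≡.refl = supported i d∉Y
    ...   | yes i∈C | no i≢d =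
            isolated-coefficient x dep supported-off-d (proj₂ (isolate d i d∈C i∈C i≢d))
      where
      supported-off-d : ∀ j → j ∉ C ∖ d → x j ≈ 0#
      supported-off-d j j∉C∖d with outside-removal {C = C} j∉C∖d
      ... | inj₁ j∉C = supported j (λ j∈Y → j∉C (Y⊆C j∈Y))
      ... | inj₂ ≡.refl = supported j d∉Y

    -- No element of a circuit can be isolated by a functional: otherwise its
    -- coefficient in every dependency vanishes, and the rest is independent.
    circuit-not-isolable : ∀ {C c} → LinCircuit vec C → c ∈ C → ∀ L → ¬ Isolates L C c
    circuit-not-isolable {C} {c} (dependent , minimal) c∈C L isolates =
      dependent λ x supported dep → minimal (C ∖ c) C∖c⊆C C∖c≢C x (off-C∖c x supported dep) dep
      where
      C∖c⊆C : C ∖ c ⊆ C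
      C∖c⊆C = proj₁ (remove-proper c∈C)
      C∖c≢C : C ∖ c ≢ C
      C∖c≢C = proj₂ (remove-proper c∈C)
      off-C∖c : ∀ x → (∀ j → j ∉ C → x j ≈ 0#) → IsDependency x → ∀ j → j ∉ C ∖ c → x j ≈ 0#
      off-C∖c x supported dep j j∉C∖c with outside-removal {C = C} j∉C∖c
      ... | inj₁ j∉C = supported j j∉C
      ... | inj₂ ≡.refl = isolated-coefficient x dep supported isolates

    independent-subset : ∀ {X X′} → X′ ⊆ X → LinIndep vec X → LinIndep vec X′
    independent-subset X′⊆X independent x supported =
      independent x (λ i i∉X → supported i (λ i∈X′ → i∉X (X′⊆X i∈X′)))

-- Walks, paths, cycles and reach sets in a graph.
module Graphs where
  open import Data.Nat as ℕ using (ℕ; zero; suc; _+_; _∸_; _≤_; _<_; z≤n; s≤s; _<?_; _≟_)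
  open import Data.Nat.Properties
  open import Data.Fin as F using (Fin; toℕ; zero; suc)
  import Data.Fin.Properties as FP
  open import Data.Product using (_×_; _,_; proj₁; proj₂; Σ; ∃)
  open import Data.Sum using (_⊎_; inj₁; inj₂)
  open import Data.Empty using (⊥-elim)
  open import Relation.Nullary using (Dec; yes; no)
  open import Relation.Nullary.Decidable using (_×-dec_; _⊎-dec_)
  open import Data.Fin.Subset using (Subset; _∈_; _∉_; _⊆_; ⁅_⁆; ∣_∣)
  import Data.Fin.Subset.Properties as SP
  open FiniteSets
  open import Relation.Binary.Definitions using (tri<; tri≈; tri>)
  open import Relation.Binary.PropositionalEquality using (_≡_; _≢_; refl; sym; trans; cong; cong₂; subst)

  -- Walks, paths and cycles in the graph with edge map 'ends'; 'anyEdge' is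
  -- a default edge used to pad edge sequences.
  module Walks {n m : ℕ} (ends : Fin m → Fin n × Fin n) (anyEdge : Fin m) where

    J : Fin m → Fin n → Fin n → Set
    J = Joins ends

    -- Sequences are indexed by ℕ (values past the end
    -- are irrelevant), which keeps index arithmetic in ℕ.
    record Walk : Set where
      constructor mkW
      field
        len  : ℕ
        vtx  : ℕ → Fin n
        edg  : ℕ → Fin m
        link : ∀ i → i < len → J (edg i) (vtx i) (vtx (suc i))
    open Walk public

    IsPath : Walk → Set
    IsPath W = ∀ i j → i ≤ len W → j ≤ len W → vtx W i ≡ vtx W j → i ≡ j

    OnWalk : Walk → Fin m → Set
    OnWalk W e = ∃ λ t → t < len W × edg W t ≡ e

    onWalk? : ∀ W e → Dec (OnWalk W e)
    onWalk? W e with least (λ t → edg W t FP.≟ e) (len W)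
    ... | inj₁ (t , t< , edg≡e , _) = yes (t , t< , edg≡e)
    ... | inj₂ none = no (λ { (t , t< , edg≡e) → none t t< edg≡e })

    edgeSet : Walk → Subset m
    edgeSet W = select (onWalk? W)

    EdgesFrom : Walk → Walk → Set
    EdgesFrom W′ W = ∀ t → t < len W′ → ∃ λ s → s < len W × edg W′ t ≡ edg W s

    edges-from-on-walk : ∀ {W′ W f} → EdgesFrom W′ W → OnWalk W′ f → OnWalk W f
    edges-from-on-walk W′⊆W (t , t< , edg≡f) with W′⊆W t t<
    ... | s , s< , same = s , s< , trans (sym same) edg≡f

    segment : (W : Walk) (a l : ℕ) → a + l ≤ len W → Walk
    segment W a l a+l≤ = mkW l (λ t → vtx W (a + t)) (λ t → edg W (a + t))
      (λ t t<l → subst (λ z → J (edg W (a + t)) (vtx W (a + t)) (vtx W z)) (sym (+-suc a t))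
        (link W (a + t) (≤-trans (+-monoʳ-< a t<l) a+l≤)))

    segment-path : ∀ W a l a+l≤ → IsPath W → IsPath (segment W a l a+l≤)
    segment-path W a l a+l≤ is-path i j i≤ j≤ same =
      +-cancelˡ-≡ a i j (is-path (a + i) (a + j) (≤-trans (+-monoʳ-≤ a i≤) a+l≤) (≤-trans (+-monoʳ-≤ a j≤) a+l≤) same)

    segment-edges : ∀ W a l a+l≤ → EdgesFrom (segment W a l a+l≤) W
    segment-edges W a l a+l≤ t t< = a + t , ≤-trans (+-monoʳ-< a t<) a+l≤ , refl

    prepend : (f : Fin m) (v : Fin n) (W : Walk) → J f v (vtx W 0) → Walk
    prepend f v W f-joins = mkW (suc (len W)) vertex edge links
      where
      vertex : ℕ → Fin n
      vertex zero    = v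
      vertex (suc t) = vtx W t
      edge : ℕ → Fin m
      edge zero    = f
      edge (suc t) = edg W t
      links : ∀ i → i < suc (len W) → J (edge i) (vertex i) (vertex (suc i))
      links zero    _         = f-joins
      links (suc i) (s≤s i<) = link W i i<

    prepend-path : ∀ f v W f-joins → IsPath W → (∀ j → j ≤ len W → vtx W j ≢ v) →
                   IsPath (prepend f v W f-joins)
    prepend-path f v W f-joins is-path v-new zero    zero    _ _ _ = refl
    prepend-path f v W f-joins is-path v-new zero    (suc j) _ j≤ v≡ = ⊥-elim (v-new j (≤-pred j≤) (sym v≡))
    prepend-path f v W f-joins is-path v-new (suc i) zero    i≤ _ ≡v = ⊥-elim (v-new i (≤-pred i≤) ≡v)
    prepend-path f v W f-joins is-path v-new (suc i) (suc j) i≤ j≤ same =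
      cong suc (is-path i j (≤-pred i≤) (≤-pred j≤) same)

    -- Extending a path W backwards by an edge f from v gives a path from v
    -- to the end of W, using only f and edges of W: prepend v if it is new,
    -- otherwise cut W down to its suffix starting at v.
    prepend-or-cut : ∀ f v (W : Walk) → J f v (vtx W 0) → IsPath W →
      Σ Walk λ P → IsPath P × vtx P 0 ≡ v × vtx P (len P) ≡ vtx W (len W) ×
                   (∀ t → t < len P → edg P t ≡ f ⊎ OnWalk W (edg P t))
    prepend-or-cut f v W f-joins is-path with least (λ j → vtx W j FP.≟ v) (suc (len W))
    ... | inj₁ (j , j< , vtx≡v , _) =
          segment W j (len W ∸ j) bound , segment-path W j (len W ∸ j) bound is-path ,
          trans (cong (vtx W) (+-identityʳ j)) vtx≡v ,
          cong (vtx W) (m+[n∸m]≡n (≤-pred j<)) ,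
          (λ t t< → inj₂ (j + t , ≤-trans (+-monoʳ-< j t<) bound , refl))
      where
      bound : j + (len W ∸ j) ≤ len W
      bound = ≤-reflexive (m+[n∸m]≡n (≤-pred j<))
    ... | inj₂ v-new =
          prepend f v W f-joins , prepend-path f v W f-joins is-path (λ j j≤ → v-new j (s≤s j≤)) ,
          refl , refl , edges
      where
      edges : ∀ t → t < suc (len W) → edg (prepend f v W f-joins) t ≡ f ⊎ OnWalk W (edg (prepend f v W f-joins) t)
      edges zero    _         = inj₁ refl
      edges (suc t) (s≤s t<) = inj₂ (t , t< , refl)

    as-Path : (W : Walk) → IsPath W → Path ends (len W)
    as-Path W is-path = record
      { vs     = λ i → vtx W (toℕ i)
      ; vs-inj = λ {i} {j} same → FP.toℕ-injective
                   (is-path (toℕ i) (toℕ j) (FP.toℕ≤pred[n] i) (FP.toℕ≤pred[n] j) same)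
      ; es     = λ i → edg W (toℕ i)
      ; joins  = λ i → subst (λ z → J (edg W (toℕ i)) (vtx W z) (vtx W (suc (toℕ i))))
                   (sym (FP.toℕ-inject₁ i)) (link W (toℕ i) (FP.toℕ<n i))
      }

    path-set-meeting-two : ∀ {Bd} W → IsPath W → 0 < len W → vtx W 0 ∈ Bd → vtx W (len W) ∈ Bd →
                           PathSetMeetingTwo ends Bd (edgeSet W)
    path-set-meeting-two {Bd} W is-path nonempty start∈ end∈ =
      len W , as-Path W is-path , edge-set , zero , F.fromℕ (len W) , ends-differ , start∈ ,
      subst (λ z → vtx W z ∈ Bd) (sym (FP.toℕ-fromℕ (len W))) end∈
      where
      edge-set : PathEdgeSet ends (as-Path W is-path) (edgeSet W)
      edge-set e = (λ e∈ → on-path (select-sound (onWalk? W) e e∈))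
                 , (λ { (i , edg≡e) → select-complete (onWalk? W) e (toℕ i , FP.toℕ<n i , edg≡e) })
        where
        on-path : OnWalk W e → ∃ λ i → Path.es (as-Path W is-path) i ≡ e
        on-path (t , t< , edg≡e) = F.fromℕ< t< , trans (cong (edg W) (FP.toℕ-fromℕ< t<)) edg≡e
      ends-differ : zero ≢ F.fromℕ (len W)
      ends-differ same = <⇒≢ nonempty (trans (cong toℕ same) (FP.toℕ-fromℕ (len W)))

    close-path : (W : Walk) → IsPath W → ∀ k → len W ≡ suc (suc k) → (f : Fin m) →
                 J f (vtx W (len W)) (vtx W 0) → Cycle ends k
    close-path W is-path k len≡ f closes = record
      { vs     = λ i → vtx W (toℕ i)
      ; vs-inj = λ {i} {j} same → FP.toℕ-injective (is-path (toℕ i) (toℕ j)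
                   (subst (toℕ i ≤_) (sym len≡) (FP.toℕ≤pred[n] i)) (subst (toℕ j ≤_) (sym len≡) (FP.toℕ≤pred[n] j)) same)
      ; es     = λ i → edg W (toℕ i)
      ; joins  = λ i → subst (λ z → J (edg W (toℕ i)) (vtx W z) (vtx W (suc (toℕ i)))) (sym (FP.toℕ-inject₁ i))
                   (link W (toℕ i) (subst (toℕ i <_) (sym len≡) (FP.toℕ<n i)))
      ; ec     = f
      ; closes = subst (λ z → J f (vtx W z) (vtx W 0)) (trans len≡ (sym (FP.toℕ-fromℕ (suc (suc k))))) closes
      }

    closed-edge-set : Walk → Fin m → Subset m
    closed-edge-set W f = select (λ e → onWalk? W e ⊎-dec (f FP.≟ e))

    closed-graphic-circuit : (W : Walk) (is-path : IsPath W) → ∀ k (len≡ : len W ≡ suc (suc k)) f closes →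
                             GraphicCircuit ends (closed-edge-set W f)
    closed-graphic-circuit W is-path k len≡ f closes = k , close-path W is-path k len≡ f closes , λ e → to e , from e
      where
      on-cycle? : ∀ e → Dec (OnWalk W e ⊎ f ≡ e)
      on-cycle? e = onWalk? W e ⊎-dec (f FP.≟ e)
      to : ∀ e → e ∈ closed-edge-set W f → (∃ λ i → edg W (toℕ {suc (suc k)} i) ≡ e) ⊎ f ≡ e
      to e e∈ with select-sound on-cycle? e e∈
      ... | inj₂ f≡e = inj₂ f≡e
      ... | inj₁ (t , t< , edg≡e) = inj₁ (F.fromℕ< (subst (t <_) len≡ t<) ,
                                          trans (cong (edg W) (FP.toℕ-fromℕ< (subst (t <_) len≡ t<))) edg≡e)
      from : ∀ e → (∃ λ i → edg W (toℕ {suc (suc k)} i) ≡ e) ⊎ f ≡ e → e ∈ closed-edge-set W f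
      from e (inj₁ (i , edg≡e)) = select-complete on-cycle? e (inj₁ (toℕ i , subst (toℕ i <_) (sym len≡) (FP.toℕ<n i) , edg≡e))
      from e (inj₂ f≡e) = select-complete on-cycle? e (inj₂ f≡e)

    record CycleWalk : Set where
      field
        walk      : Walk
        closes-up : vtx walk (len walk) ≡ vtx walk 0
        injective : ∀ i j → i < len walk → j < len walk → vtx walk i ≡ vtx walk j → i ≡ j
        length≥3  : 3 ≤ len walk
    open CycleWalk public

    same-edge-ends : ∀ {e a b c d} → J e a b → J e c d → (a ≡ c × b ≡ d) ⊎ (a ≡ d × b ≡ c)
    same-edge-ends (inj₁ p) (inj₁ q) = let r = trans (sym p) q in inj₁ (cong proj₁ r , cong proj₂ r)
    same-edge-ends (inj₁ p) (inj₂ q) = let r = trans (sym p) q in inj₂ (cong proj₁ r , cong proj₂ r)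
    same-edge-ends (inj₂ p) (inj₁ q) = let r = trans (sym p) q in inj₂ (cong proj₂ r , cong proj₁ r)
    same-edge-ends (inj₂ p) (inj₂ q) = let r = trans (sym p) q in inj₁ (cong proj₂ r , cong proj₁ r)

    module _ (C : CycleWalk) where
      private
        W : Walk
        W = walk C
        N : ℕ
        N = len W

      injective-up-to-end : ∀ i j → i < N → j ≤ N → vtx W i ≡ vtx W j → i ≡ j ⊎ (i ≡ 0 × j ≡ N)
      injective-up-to-end i j i< j≤ same with m≤n⇒m<n∨m≡n j≤
      ... | inj₁ j< = inj₁ (injective C i j i< j< same)
      ... | inj₂ refl = inj₂ (injective C i 0 i< (≤-trans (s≤s z≤n) (length≥3 C)) (trans same (closes-up C)) , refl)

      -- The edges of a cycle are pairwise distinct (using length ≥ 3).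
      edges-distinct : ∀ r r′ → r < N → r′ < N → edg W r ≡ edg W r′ → r ≡ r′
      edges-distinct r r′ r< r′< same
        with same-edge-ends (subst (λ z → J z (vtx W r) (vtx W (suc r))) same (link W r r<)) (link W r′ r′<)
      ... | inj₁ (p , _) = injective C r r′ r< r′< p
      ... | inj₂ (p , p′) with injective-up-to-end r (suc r′) r< r′< p | injective-up-to-end r′ (suc r) r′< r< (sym p′)
      ...   | inj₁ e₁ | inj₁ e₂ = ⊥-elim (m≢1+m+n r {1} (trans e₁ (trans (cong suc e₂) (cong suc (+-comm 1 r)))))
      ...   | inj₁ e₁ | inj₂ (e₂ , e₃) = ⊥-elim (<⇒≱ (length≥3 C) (≤-reflexive (trans (sym e₃) (cong suc (trans e₁ (cong suc e₂))))))
      ...   | inj₂ (e₁ , e₃) | inj₁ e₂ = ⊥-elim (<⇒≱ (length≥3 C) (≤-reflexive (trans (sym e₃) (cong suc (trans e₂ (cong suc e₁))))))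
      ...   | inj₂ (e₁ , e₃) | inj₂ (e₂ , e₄) = ⊥-elim (<⇒≱ (length≥3 C) (≤-trans (≤-reflexive (trans (sym e₄) (cong suc e₁))) (n≤1+n 1)))

    extend : ∀ {A : Set} {K} → (Fin K → A) → A → ℕ → A
    extend {K = K} f default j with j <? K
    ... | yes j< = f (F.fromℕ< j<)
    ... | no _ = default

    extend-< : ∀ {A : Set} {K} (f : Fin K → A) default {j} (j< : j < K) → extend f default j ≡ f (F.fromℕ< j<)
    extend-< {K = K} f default {j} j< with j <? K
    ... | yes _ = cong f (FP.fromℕ<-cong j j refl _ j<)
    ... | no j≮K = ⊥-elim (j≮K j<)

    extend-at : ∀ {A : Set} {K} (f : Fin K → A) default (i : Fin K) → extend f default (toℕ i) ≡ f i
    extend-at f default i = trans (extend-< f default (FP.toℕ<n i)) (cong f (FP.fromℕ<-toℕ i (FP.toℕ<n i)))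

    extend-≥ : ∀ {A : Set} {K} (f : Fin K → A) default {j} → K ≤ j → extend f default j ≡ default
    extend-≥ {K = K} f default {j} K≤j with j <? K
    ... | yes j<K = ⊥-elim (<⇒≱ j<K K≤j)
    ... | no _ = refl

    extend-injective : ∀ {K} (vs : Fin K → Fin n) default → (∀ {i j} → vs i ≡ vs j → i ≡ j) →
                       ∀ i j → i < K → j < K → extend vs default i ≡ extend vs default j → i ≡ j
    extend-injective vs default vs-inj i j i< j< same =
      trans (sym (FP.toℕ-fromℕ< i<)) (trans (cong toℕ (vs-inj
        (trans (sym (extend-< vs default i<)) (trans same (extend-< vs default j<))))) (FP.toℕ-fromℕ< j<))

    extend-links : ∀ {K} (vs : Fin (suc K) → Fin n) (es : Fin K → Fin m) dv de →
      (∀ i → J (es i) (vs (F.inject₁ i)) (vs (suc i))) →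
      ∀ j → j < K → J (extend es de j) (extend vs dv j) (extend vs dv (suc j))
    extend-links {K} vs es dv de joins j j< =
      subst₃ J (sym (extend-< es de j<)) (sym at-j) (sym at-1+j) (joins i)
      where
      i : Fin K
      i = F.fromℕ< j<
      at-j : extend vs dv j ≡ vs (F.inject₁ i)
      at-j = trans (cong (extend vs dv) (sym (trans (FP.toℕ-inject₁ i) (FP.toℕ-fromℕ< j<)))) (extend-at vs dv (F.inject₁ i))
      at-1+j : extend vs dv (suc j) ≡ vs (suc i)
      at-1+j = trans (cong (extend vs dv) (sym (cong suc (FP.toℕ-fromℕ< j<)))) (extend-at vs dv (suc i))

    module CycleAsWalk {k : ℕ} (cy : Cycle ends k) where
      open Cycle cy

      fv : ℕ → Fin n
      fv = extend vs (vs zero)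

      fe : ℕ → Fin m
      fe = extend es ec

      fe-last : fe (suc (suc k)) ≡ ec
      fe-last = extend-≥ es ec ≤-refl

      fW : Walk
      fW = mkW (suc (suc (suc k))) fv fe links
        where
        links : ∀ j → j < suc (suc (suc k)) → J (fe j) (fv j) (fv (suc j))
        links j j< with m<1+n⇒m<n∨m≡n j<
        ... | inj₁ j<′ = extend-links vs es (vs zero) ec joins j j<′
        ... | inj₂ refl = subst₃ J (sym fe-last) (sym last-vertex) (sym (extend-≥ vs (vs zero) ≤-refl)) closes
          where
          last-vertex : fv (suc (suc k)) ≡ vs (F.fromℕ (suc (suc k)))
          last-vertex = trans (cong fv (sym (FP.toℕ-fromℕ (suc (suc k))))) (extend-at vs (vs zero) (F.fromℕ (suc (suc k))))

      as-CycleWalk : CycleWalk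
      as-CycleWalk = record
        { walk      = fW
        ; closes-up = trans (extend-≥ vs (vs zero) ≤-refl) (sym (extend-< vs (vs zero) (s≤s z≤n)))
        ; injective = extend-injective vs (vs zero) vs-inj
        ; length≥3  = s≤s (s≤s (s≤s z≤n))
        }

      fE⇒ : ∀ e → OnWalk fW e → (∃ λ i → es i ≡ e) ⊎ ec ≡ e
      fE⇒ e (t , t< , fe≡e) with m<1+n⇒m<n∨m≡n t<
      ... | inj₁ t<′ = inj₁ (F.fromℕ< t<′ , trans (sym (extend-< es ec t<′)) fe≡e)
      ... | inj₂ refl = inj₂ (trans (sym fe-last) fe≡e)

      fE⇐ : ∀ e → (∃ λ i → es i ≡ e) ⊎ ec ≡ e → OnWalk fW e
      fE⇐ e (inj₁ (i , es≡e)) = toℕ i , <-trans (FP.toℕ<n i) (n<1+n _) , trans (extend-at es ec i) es≡e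
      fE⇐ e (inj₂ ec≡e) = suc (suc k) , n<1+n _ , trans fe-last ec≡e

    record BoundaryPath (Bd : Subset n) : Set where
      field
        route          : Walk
        route-path     : IsPath route
        route-nonempty : 0 < len route
        starts-in      : vtx route 0 ∈ Bd
        ends-in        : vtx route (len route) ∈ Bd
        inner-outside  : ∀ t → 0 < t → t < len route → vtx route t ∉ Bd
    open BoundaryPath public

    first-boundary-segment : ∀ {Bd} (W : Walk) → IsPath W → ∀ i g → i + suc g ≤ len W →
      vtx W i ∈ Bd → vtx W (i + suc g) ∈ Bd → Σ (BoundaryPath Bd) λ P → EdgesFrom (route P) W
    first-boundary-segment {Bd} W is-path i g bound start∈ end∈ with least (λ d → vtx W (i + suc d) SP.∈? Bd) (suc g)
    ... | inj₂ none = ⊥-elim (none g ≤-refl end∈)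
    ... | inj₁ (d , d< , next∈ , none-before) = record
          { route = S ; route-path = segment-path W i (suc d) bound′ is-path ; route-nonempty = s≤s z≤n
          ; starts-in = subst (_∈ Bd) (cong (vtx W) (sym (+-identityʳ i))) start∈
          ; ends-in = next∈
          ; inner-outside = inner } , segment-edges W i (suc d) bound′
      where
      bound′ : i + suc d ≤ len W
      bound′ = ≤-trans (+-monoʳ-≤ i d<) bound
      S : Walk
      S = segment W i (suc d) bound′
      inner : ∀ t → 0 < t → t < suc d → vtx S t ∉ Bd
      inner (suc t) _ (s≤s t<) = none-before t t<

    position : (ℕ → Fin n) → ℕ → Fin n → ℕ
    position f K v with least (λ j → f j FP.≟ v) K
    ... | inj₁ (j , _ , _ , _) = j
    ... | inj₂ _ = K

    position-of : ∀ f K → (∀ i j → i < K → j < K → f i ≡ f j → i ≡ j) → ∀ j → j < K → position f K (f j) ≡ j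
    position-of f K injective j j< with least (λ i → f i FP.≟ f j) K
    ... | inj₁ (i , i< , eq , _) = injective i j i< j< eq
    ... | inj₂ none = ⊥-elim (none j j< refl)

    boundary-path-from-to : ∀ {Bd} (W : Walk) → IsPath W → ∀ {a b} → a < b → b ≤ len W →
      vtx W a ∈ Bd → vtx W b ∈ Bd → Σ (BoundaryPath Bd) λ P → EdgesFrom (route P) W
    boundary-path-from-to W is-path {a} {b} a<b b≤ a∈ b∈ =
      first-boundary-segment W is-path a (b ∸ suc a) (subst (_≤ len W) (sym b≡) b≤)
        a∈ (subst (λ z → vtx W z ∈ _) (sym b≡) b∈)
      where
      b≡ : a + suc (b ∸ suc a) ≡ b
      b≡ = trans (+-suc a (b ∸ suc a)) (m+[n∸m]≡n a<b)

    boundary-path-between : ∀ {Bd} (W : Walk) → IsPath W → ∀ a b → a ≤ len W → b ≤ len W → a ≢ b →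
      vtx W a ∈ Bd → vtx W b ∈ Bd → Σ (BoundaryPath Bd) λ P → EdgesFrom (route P) W
    boundary-path-between W is-path a b a≤ b≤ a≢b a∈ b∈ with <-cmp a b
    ... | tri≈ _ a≡b _ = ⊥-elim (a≢b a≡b)
    ... | tri< a<b _ _ = boundary-path-from-to W is-path a<b b≤ a∈ b∈
    ... | tri> _ _ b<a = boundary-path-from-to W is-path b<a a≤ b∈ a∈

    -- Rotating a cycle of length N1+1 to start right after its edge at
    -- position q gives a path through all its vertices avoiding that edge:
    -- step t of the path is step 'pos t' of the cycle, namely q+1+t for
    -- t < c = N1 - q, and t - c once the path has wrapped around.
    module Rotation (C : CycleWalk) (q : ℕ) (q< : q < len (walk C)) where
      private
        W : Walk
      W = walk C
      N1 : ℕ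
      N1 = ℕ.pred (len W)
      eqN : len W ≡ suc N1
      eqN = sym (suc-pred (len W) {{ℕ.>-nonZero (≤-trans (s≤s z≤n) q<)}})
      q≤ : q ≤ N1
      q≤ = ≤-pred (subst (q <_) eqN q<)
      c : ℕ
      c = N1 ∸ q
      q+c≡N1 : q + c ≡ N1
      q+c≡N1 = m+[n∸m]≡n q≤

      pos : ℕ → ℕ
      pos t with t <? c
      ... | yes _ = q + suc t
      ... | no _ = t ∸ c

      wrapped? : ∀ t → t < c ⊎ c ≤ t
      wrapped? t with t <? c
      ... | yes p = inj₁ p
      ... | no p = inj₂ (≮⇒≥ p)

      pos-before-wrap : ∀ {t} → t < c → pos t ≡ q + suc t
      pos-before-wrap {t} t< with t <? c
      ... | yes _ = refl
      ... | no ¬p = ⊥-elim (¬p t<)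
      pos-after-wrap : ∀ {t} → c ≤ t → pos t ≡ t ∸ c
      pos-after-wrap {t} t≥ with t <? c
      ... | yes p = ⊥-elim (<⇒≱ p t≥)
      ... | no _ = refl

      len≡ : len W ≡ suc (q + c)
      len≡ = trans eqN (cong suc (sym q+c≡N1))

      pos-< : ∀ t → t ≤ N1 → pos t < len W
      pos-< t t≤ with wrapped? t
      ... | inj₁ t<c = subst (_< len W) (sym (pos-before-wrap t<c)) (subst (q + suc t <_) (sym len≡) (s≤s (+-monoʳ-≤ q t<c)))
      ... | inj₂ c≤t = subst (_< len W) (sym (pos-after-wrap c≤t)) (subst (t ∸ c <_) (sym eqN) (s≤s (≤-trans (m∸n≤m t c) t≤)))

      after-wrap-bound : ∀ t → t ≤ N1 → t ∸ c ≤ q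
      after-wrap-bound t t≤ = subst (t ∸ c ≤_) (m+n∸n≡m q c) (∸-monoˡ-≤ c (subst (t ≤_) (sym q+c≡N1) t≤))

      pos-inj : ∀ t t' → t ≤ N1 → t' ≤ N1 → pos t ≡ pos t' → t ≡ t'
      pos-inj t t' t≤ t'≤ eq with wrapped? t | wrapped? t'
      ... | inj₁ a | inj₁ b = suc-injective (+-cancelˡ-≡ q (suc t) (suc t') (trans (sym (pos-before-wrap a)) (trans eq (pos-before-wrap b))))
      ... | inj₂ a | inj₂ b = ∸-cancelʳ-≡ a b (trans (sym (pos-after-wrap a)) (trans eq (pos-after-wrap b)))
      ... | inj₁ a | inj₂ b = ⊥-elim (<⇒≱ (s≤s (m≤m+n q t)) (subst (_≤ q) (trans (sym (pos-after-wrap b)) (trans (sym eq) (trans (pos-before-wrap a) (+-suc q t)))) (after-wrap-bound t' t'≤)))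
      ... | inj₂ a | inj₁ b = ⊥-elim (<⇒≱ (s≤s (m≤m+n q t')) (subst (_≤ q) (trans (sym (pos-after-wrap a)) (trans eq (trans (pos-before-wrap b) (+-suc q t')))) (after-wrap-bound t t≤)))

      -- Consecutive steps of the rotation are consecutive in the cycle,
      -- using that the cycle closes up at the wrap-around.
      rotated-link : ∀ t → t < N1 → J (edg W (pos t)) (vtx W (pos t)) (vtx W (pos (suc t)))
      rotated-link t t< = subst (λ z → J (edg W (pos t)) (vtx W (pos t)) z) (next-position t t<) (link W (pos t) (pos-< t (<⇒≤ t<)))
        where
        next-position : ∀ t → t < N1 → vtx W (suc (pos t)) ≡ vtx W (pos (suc t))
        next-position t t< with wrapped? (suc t) | wrapped? t
        ... | inj₁ st<c | _ = cong (vtx W) (trans (cong suc (pos-before-wrap (<-trans (n<1+n t) st<c))) (trans (sym (+-suc q (suc t))) (sym (pos-before-wrap st<c))))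
        ... | inj₂ c≤st | inj₁ t<c =
              trans (cong (λ z → vtx W (suc z)) (pos-before-wrap t<c))
                (trans (cong (vtx W) (trans (cong suc (trans (cong (q +_) tc) q+c≡N1)) (sym eqN)))
                  (trans (closes-up C) (cong (vtx W) (sym (trans (pos-after-wrap (≤-reflexive (sym tc))) (subst (λ z → z ∸ c ≡ 0) (sym tc) (n∸n≡0 c)))))))
          where
          tc : suc t ≡ c
          tc = ≤-antisym t<c c≤st
        ... | inj₂ c≤st | inj₂ c≤t = cong (vtx W) (trans (cong suc (pos-after-wrap c≤t)) (trans (sym (+-∸-assoc 1 c≤t)) (sym (pos-after-wrap c≤st))))

      rotated : Walk
      rotated = mkW N1 (λ t → vtx W (pos t)) (λ t → edg W (pos t)) rotated-link

      rotated-path : IsPath rotated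
      rotated-path t t' t≤ t'≤ eq = pos-inj t t' t≤ t'≤ (injective C _ _ (pos-< t t≤) (pos-< t' t'≤) eq)

      pos-≢q : ∀ t → t < N1 → pos t ≢ q
      pos-≢q t t< eq with wrapped? t
      ... | inj₁ a = m≢1+m+n q (trans (sym eq) (trans (pos-before-wrap a) (+-suc q t)))
      ... | inj₂ ¬p = <⇒≢ lt (trans (sym (pos-after-wrap ¬p)) eq)
        where
        lt : t ∸ c < q
        lt = +-cancelʳ-< c (t ∸ c) q (subst (_< q + c) (sym (m∸n+n≡m ¬p)) (subst (t <_) (sym q+c≡N1) t<))

      pos-N1 : pos N1 ≡ q
      pos-N1 = trans (pos-after-wrap (subst (c ≤_) q+c≡N1 (m≤n+m c q))) (trans (cong (_∸ c) (sym q+c≡N1)) (m+n∸n≡m q c))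

      pos-onto : ∀ r → r < len W → r ≢ q → ∃ λ t → t < N1 × pos t ≡ r
      pos-onto r r< r≢q with <-cmp r q
      ... | tri≈ _ e _ = ⊥-elim (r≢q e)
      ... | tri< r<q _ _ = r + c , subst (r + c <_) q+c≡N1 (+-monoˡ-< c r<q) , trans (pos-after-wrap (m≤n+m c r)) (m+n∸n≡m r c)
      ... | tri> _ _ q<r = r ∸ suc q , t<N1 , trans (pos-before-wrap t<c) (trans (+-suc q (r ∸ suc q)) (m+[n∸m]≡n q<r))
        where
        r≤N1 : r ≤ N1
        r≤N1 = ≤-pred (subst (r <_) eqN r<)
        t<c : r ∸ suc q < c
        t<c = +-cancelˡ-< q (r ∸ suc q) c (subst (_≤ q + c) (sym (m+[n∸m]≡n q<r)) (subst (r ≤_) (sym q+c≡N1) r≤N1))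
        t<N1 : r ∸ suc q < N1
        t<N1 = <-≤-trans t<c (subst (c ≤_) q+c≡N1 (m≤n+m c q))

      preimage : ∀ p → p < len W → ∃ λ t → t ≤ N1 × pos t ≡ p
      preimage p p< with p ℕ.≟ q
      ... | yes refl = N1 , ≤-refl , pos-N1
      ... | no p≢q with pos-onto p p< p≢q
      ...   | t , t< , pos-t = t , <⇒≤ t< , pos-t

      boundary-path-avoiding : ∀ {Bd} p₁ p₂ → p₁ < len W → p₂ < len W → p₁ ≢ p₂ → vtx W p₁ ∈ Bd → vtx W p₂ ∈ Bd →
        Σ (BoundaryPath Bd) λ Q → ∀ f → OnWalk (route Q) f → OnWalk W f × f ≢ edg W q
      boundary-path-avoiding p₁ p₂ p₁< p₂< p₁≢p₂ p₁∈ p₂∈ with preimage p₁ p₁< | preimage p₂ p₂<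
      ... | t₁ , t₁≤ , refl | t₂ , t₂≤ , refl with boundary-path-between rotated rotated-path t₁ t₂ t₁≤ t₂≤
                                                    (λ { refl → p₁≢p₂ refl }) p₁∈ p₂∈
      ...   | Q , Q⊆rotated = Q , λ f f∈Q → on-cycle f (edges-from-on-walk {route Q} {rotated} Q⊆rotated f∈Q)
        where
        on-cycle : ∀ f → OnWalk rotated f → OnWalk W f × f ≢ edg W q
        on-cycle f (t , t< , refl) = (pos t , pos-< t (<⇒≤ t<) , refl)
                                   , (λ same → pos-≢q t t< (edges-distinct C (pos t) q (pos-< t (<⇒≤ t<)) q< same))

    module PathAsWalk {k : ℕ} (p : Path ends k) where
      open Path p

      pW : Walk
      pW = mkW k (extend vs (vs zero)) (extend es anyEdge) (extend-links vs es (vs zero) anyEdge joins)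

      pW-path : IsPath pW
      pW-path i j i≤ j≤ = extend-injective vs (vs zero) vs-inj i j (s≤s i≤) (s≤s j≤)

      pv-at : ∀ i → vtx pW (toℕ i) ≡ vs i
      pv-at = extend-at vs (vs zero)

      pE⇒ : ∀ e → OnWalk pW e → ∃ λ i → es i ≡ e
      pE⇒ e (t , t< , edg≡e) = F.fromℕ< t< , trans (sym (extend-< es anyEdge t<)) edg≡e

    -- The reach set Rch v of v in the subgraph with edge set F: the vertices
    -- joined to v by a path in F, computed as the n-th iterate of one-step
    -- closure starting from {v}.
    module Reach (F : Subset m) where
      OneStep : Subset n → Fin n → Set
      OneStep S v = v ∈ S ⊎ ∃ λ f → f ∈ F × ((proj₁ (ends f) ≡ v × proj₂ (ends f) ∈ S)
                                           ⊎ (proj₂ (ends f) ≡ v × proj₁ (ends f) ∈ S))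

      oneStep? : ∀ S v → Dec (OneStep S v)
      oneStep? S v = (v SP.∈? S) ⊎-dec FP.any? (λ f → (f SP.∈? F) ×-dec
        (((proj₁ (ends f) FP.≟ v) ×-dec (proj₂ (ends f) SP.∈? S)) ⊎-dec
         ((proj₂ (ends f) FP.≟ v) ×-dec (proj₁ (ends f) SP.∈? S))))

      step : Subset n → Subset n
      step S = select (oneStep? S)

      iter : ℕ → Subset n → Subset n
      iter zero    S = S
      iter (suc k) S = step (iter k S)

      Rch : Fin n → Subset n
      Rch v = iter n ⁅ v ⁆

      step-⊇ : ∀ {S} → S ⊆ step S
      step-⊇ {S} {x} x∈S = select-complete (oneStep? S) x (inj₁ x∈S)

      iter-⊇ : ∀ k {S} → S ⊆ iter k S
      iter-⊇ zero    x∈ = x∈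
      iter-⊇ (suc k) x∈ = step-⊇ (iter-⊇ k x∈)

      Closed : Subset n → Set
      Closed T = ∀ f → f ∈ F → (proj₁ (ends f) ∈ T → proj₂ (ends f) ∈ T) × (proj₂ (ends f) ∈ T → proj₁ (ends f) ∈ T)

      step-min : ∀ {S T} → Closed T → S ⊆ T → step S ⊆ T
      step-min {S} {T} closed S⊆T {x} x∈ with select-sound (oneStep? S) x x∈
      ... | inj₁ x∈S = S⊆T x∈S
      ... | inj₂ (f , f∈F , inj₁ (refl , y∈S)) = proj₂ (closed f f∈F) (S⊆T y∈S)
      ... | inj₂ (f , f∈F , inj₂ (refl , y∈S)) = proj₁ (closed f f∈F) (S⊆T y∈S)

      iter-min : ∀ k {S T} → Closed T → S ⊆ T → iter k S ⊆ T
      iter-min zero    closed S⊆T = S⊆T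
      iter-min (suc k) closed S⊆T = step-min closed (iter-min k closed S⊆T)

      stable-or-large : ∀ S → 0 < ∣ S ∣ → ∀ k → step (iter k S) ≡ iter k S ⊎ k < ∣ iter k S ∣
      stable-or-large S nonempty zero with step S ≟S S
      ... | yes stable = inj₁ stable
      ... | no _ = inj₂ nonempty
      stable-or-large S nonempty (suc k) with step (step (iter k S)) ≟S step (iter k S)
      ... | yes stable = inj₁ stable
      ... | no unstable with stable-or-large S nonempty k
      ...   | inj₁ stable = ⊥-elim (unstable (cong step stable))
      ...   | inj₂ large with step (iter k S) ≟S iter k S
      ...     | yes stable = ⊥-elim (unstable (cong step stable))
      ...     | no grows = inj₂ (≤-trans (s≤s large) (proper-smaller step-⊇ (λ same → grows (sym same))))

      -- After n steps the iteration is stable, as no subset has more than n elements.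
      Rch-stable : ∀ v → step (Rch v) ≡ Rch v
      Rch-stable v with stable-or-large ⁅ v ⁆ (≤-reflexive (sym (SP.∣⁅x⁆∣≡1 v))) n
      ... | inj₁ stable = stable
      ... | inj₂ large = ⊥-elim (<⇒≱ large (SP.∣p∣≤n (Rch v)))

      Rch-self : ∀ v → v ∈ Rch v
      Rch-self v = iter-⊇ n (SP.x∈⁅x⁆ v)

      Rch-closed : ∀ v → Closed (Rch v)
      Rch-closed v f f∈F =
        (λ x∈ → subst (proj₂ (ends f) ∈_) (Rch-stable v) (select-complete (oneStep? (Rch v)) _ (inj₂ (f , f∈F , inj₂ (refl , x∈)))))
        , (λ y∈ → subst (proj₁ (ends f) ∈_) (Rch-stable v) (select-complete (oneStep? (Rch v)) _ (inj₂ (f , f∈F , inj₁ (refl , y∈)))))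

      Rch-adj : ∀ f → f ∈ F → Rch (proj₁ (ends f)) ≡ Rch (proj₂ (ends f))
      Rch-adj f f∈F = SP.⊆-antisym
        (iter-min n (Rch-closed _) (singleton-⊆ (proj₂ (Rch-closed _ f f∈F) (Rch-self _))))
        (iter-min n (Rch-closed _) (singleton-⊆ (proj₁ (Rch-closed _ f f∈F) (Rch-self _))))

      Rch-eq : ∀ {v w} → w ∈ Rch v → Rch w ≡ Rch v
      Rch-eq {v} {w} w∈ = select-sound same-as-v? w (iter-min n closed (singleton-⊆ (select-complete same-as-v? v refl)) w∈)
        where
        same-as-v? : ∀ x → Dec (Rch x ≡ Rch v)
        same-as-v? x = Rch x ≟S Rch v
        closed : Closed (select same-as-v?)
        closed f f∈F = (λ x∈ → select-complete same-as-v? _ (trans (sym (Rch-adj f f∈F)) (select-sound same-as-v? _ x∈)))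
                     , (λ y∈ → select-complete same-as-v? _ (trans (Rch-adj f f∈F) (select-sound same-as-v? _ y∈)))

      InF : Walk → Set
      InF W = ∀ t → t < len W → edg W t ∈ F

      PathToward : Fin n → Subset n → Set
      PathToward w S = Σ Walk λ P → IsPath P × vtx P 0 ≡ w × vtx P (len P) ∈ S × InF P

      step-back : ∀ {f w x S} → f ∈ F → J f w x → PathToward x S → PathToward w S
      step-back {f} {w} f∈F f-joins (P , is-path , refl , end∈ , P⊆F) with prepend-or-cut f w P f-joins is-path
      ... | P′ , is-path′ , start′ , end′ , P′-edges = P′ , is-path′ , start′ , subst (_∈ _) (sym end′) end∈ , P′⊆F
        where
        P′⊆F : InF P′
        P′⊆F t t< with P′-edges t t<
        ... | inj₁ is-f = subst (_∈ F) (sym is-f) f∈F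
        ... | inj₂ (s , s< , same) = subst (_∈ F) same (P⊆F s s<)

      iter-path : ∀ k {S w} → w ∈ iter k S → PathToward w S
      iter-path zero {S} {w} w∈ = mkW 0 (λ _ → w) (λ _ → anyEdge) (λ _ ()) , trivial , refl , w∈ , (λ _ ())
        where
        trivial : IsPath (mkW 0 (λ _ → w) (λ _ → anyEdge) (λ _ ()))
        trivial zero zero _ _ _ = refl
      iter-path (suc k) {S} {w} w∈ with select-sound (oneStep? (iter k S)) w w∈
      ... | inj₁ w∈′ = iter-path k w∈′
      ... | inj₂ (f , f∈F , inj₁ (first≡w , second∈)) =
            step-back f∈F (inj₁ (cong₂ _,_ first≡w refl)) (iter-path k second∈)
      ... | inj₂ (f , f∈F , inj₂ (second≡w , first∈)) =
            step-back f∈F (inj₂ (cong₂ _,_ refl second≡w)) (iter-path k first∈)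

      Rch-path : ∀ {v w} → w ∈ Rch v → Σ Walk λ P → IsPath P × vtx P 0 ≡ w × vtx P (len P) ≡ v × InF P
      Rch-path w∈ with iter-path n w∈
      ... | P , is-path , start , end∈ , P⊆F = P , is-path , start , SP.x∈⁅y⁆⇒x≡y _ end∈ , P⊆F

-- Dirichlet vectors, potentials, and the Dirichlet circuits of paths and cycles.
module Potentials where
  open LinearAlgebra
  open Graphs
  open FiniteSets
  open import Data.Nat as ℕ using (ℕ; zero; suc; z≤n; s≤s; _<?_)
  import Data.Nat.Properties as ℕₚ
  open import Data.Fin using (Fin; zero; suc; toℕ; fromℕ<; _≟_)
  import Data.Fin.Properties as Finₚ
  open import Data.Fin.Subset using (Subset; _∈_; _∉_) renaming (_-_ to _∖_)
  import Data.Fin.Subset.Properties as Subsetₚ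
  open import Data.Vec using (lookup; _∷_; here; there)
  import Data.Vec.Properties as Vecₚ
  open import Data.Bool using (Bool; true; false; if_then_else_; not; _xor_)
  import Data.Bool.Properties as Boolₚ
  open import Data.Product using (_×_; _,_; proj₁; proj₂; ∃)
  open import Data.Sum using (_⊎_; inj₁; inj₂)
  open import Data.Empty using (⊥-elim)
  open import Relation.Nullary using (¬_; yes; no)
  open import Relation.Nullary.Decidable using (⌊_⌋; _×-dec_)
  open import Relation.Binary.PropositionalEquality as ≡ using (_≡_; _≢_)

  -- after s j = [s < j].  Profiles of potentials along walks are built from
  -- these: they change value only when passing position s.
  after : ℕ → ℕ → Bool
  after s j = ⌊ s <? j ⌋

  after-flat : ∀ s r → r ≢ s → after s r ≡ after s (suc r)
  after-flat s r r≢s with s <? r | s <? suc r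
  ... | yes _ | yes _ = ≡.refl
  ... | no _  | no _  = ≡.refl
  ... | yes s<r | no s≮1+r = ⊥-elim (s≮1+r (ℕₚ.m<n⇒m<1+n s<r))
  ... | no s≮r | yes s<1+r with ℕₚ.m<1+n⇒m<n∨m≡n s<1+r
  ...   | inj₁ s<r = ⊥-elim (s≮r s<r)
  ...   | inj₂ s≡r = ⊥-elim (r≢s (≡.sym s≡r))

  after-at : ∀ s → after s s ≡ false
  after-at s with s <? s
  ... | yes s<s = ⊥-elim (ℕₚ.<-irrefl ≡.refl s<s)
  ... | no _ = ≡.refl

  after-next : ∀ s → after s (suc s) ≡ true
  after-next s with s <? suc s
  ... | yes _ = ≡.refl
  ... | no s≮1+s = ⊥-elim (s≮1+s (ℕₚ.n<1+n s))

  after-past : ∀ s j → s ℕ.< j → after s j ≡ true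
  after-past s j s<j with s <? j
  ... | yes _ = ≡.refl
  ... | no s≮j = ⊥-elim (s≮j s<j)

  between : ℕ → ℕ → ℕ → Bool
  between s q j = after s j xor after q j

  between-flat : ∀ s q r → r ≢ s → r ≢ q → between s q r ≡ between s q (suc r)
  between-flat s q r r≢s r≢q = ≡.cong₂ _xor_ (after-flat s r r≢s) (after-flat q r r≢q)

  between-jumps : ∀ s q → s ≢ q → between s q s ≢ between s q (suc s)
  between-jumps s q s≢q jump-free = b≢not-b (begin
    after q s               ≡⟨ ≡.cong (_xor after q s) (after-at s) ⟨
    between s q s            ≡⟨ jump-free ⟩
    between s q (suc s)      ≡⟨ ≡.cong (_xor after q (suc s)) (after-next s) ⟩
    true xor after q (suc s) ≡⟨ ≡.cong (true xor_) (after-flat q s s≢q) ⟨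
    not (after q s)          ∎)
    where
    open ≡.≡-Reasoning
    b≢not-b : ∀ {b} → b ≢ not b
    b≢not-b {false} ()
    b≢not-b {true} ()

  between-past : ∀ s q j → s ℕ.< j → q ℕ.< j → between s q j ≡ false
  between-past s q j s<j q<j = ≡.cong₂ _xor_ (after-past s j s<j) (after-past q j q<j)

  -- Flipping a profile by a fixed flag preserves where it changes.
  xor-injective : ∀ flag {a b} → flag xor a ≡ flag xor b → a ≡ b
  xor-injective false eq = eq
  xor-injective true  eq = Boolₚ.not-injective eq

  module Dirichlet (R : CommutativeRing 0ℓ 0ℓ) (isField : IsField R)
                   {n m : ℕ} (ends : Fin m → Fin n × Fin n) (B : Subset n)
                   (network : IsNetwork ends B)
                   (u : Fin n → CommutativeRing.Carrier R) (u-injective : Linear.InjectiveOn R B u)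
                   (anyEdge : Fin m) where
    open FieldFacts R isField
    open Walks ends anyEdge
    open Linear R using (edgeVec; dirichletVec; LinIndep; LinCircuit)

    vec : Fin (suc m) → Fin (suc n) → Carrier
    vec = dirichletVec ends B u

    open Separation R isField vec public

    ∈B⇒lookup : ∀ {v} → v ∈ B → lookup B v ≡ true
    ∈B⇒lookup = Vecₚ.[]=⇒lookup

    lookup⇒∈B : ∀ {v} → lookup B v ≡ true → v ∈ B
    lookup⇒∈B {v} = Vecₚ.lookup⇒[]= v B

    φ : Fin n → Fin (suc n) → Carrier
    φ v t = if lookup B v then u v * δ zero t else δ (suc v) t

    φ-boundary : ∀ {v} t → v ∈ B → φ v t ≈ u v * δ zero t
    φ-boundary {v} t v∈B with lookup B v | ∈B⇒lookup v∈B
    ... | true | _ = ≈-refl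

    endpoints-not-both-boundary : ∀ f → ¬ (proj₁ (ends f) ∈ B × proj₂ (ends f) ∈ B)
    endpoints-not-both-boundary f (a∈B , b∈B) =
      proj₂ (proj₂ (proj₂ (proj₂ network))) _ _ a∈B b∈B (f , inj₁ ≡.refl)

    edge-vector : ∀ {f a b} → J f a b → ∃ λ s → ∀ t → vec (suc f) t ≈ sign s * (φ a t - φ b t)
    edge-vector {f} (inj₁ ends≡) with ends f | ends≡ | endpoints-not-both-boundary f
    ... | (a , b) | ≡.refl | not-both = oriented a b not-both
      where
      oriented : ∀ a b → ¬ (a ∈ B × b ∈ B) → ∃ λ s → ∀ t → edgeVec B u a b t ≈ sign s * (φ a t - φ b t)
      oriented a b not-both with lookup B a in la | lookup B b in lb
      ... | false | false = true , λ t → ≈-sym (*-identityˡ _)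
      ... | false | true  = true , λ t → ≈-sym (*-identityˡ _)
      ... | true  | false = false , λ t → begin
            δ (suc b) t - u a * δ zero t     ≈⟨ ⁻¹-anti-homo‿- (u a * δ zero t) (δ (suc b) t) ⟨
            - (u a * δ zero t - δ (suc b) t) ≈⟨ -1*x≈-x _ ⟨
            - 1# * (u a * δ zero t - δ (suc b) t) ∎
      ... | true  | true  = ⊥-elim (not-both (lookup⇒∈B la , lookup⇒∈B lb))
    edge-vector {f} {a} {b} (inj₂ ends≡) with edge-vector {f} {b} {a} (inj₁ ends≡)
    ... | s , vec≈ = not s , λ t → begin
          vec (suc f) t                  ≈⟨ vec≈ t ⟩
          sign s * (φ b t - φ a t)       ≈⟨ *-congˡ (⁻¹-anti-homo‿- (φ a t) (φ b t)) ⟨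
          sign s * (- (φ a t - φ b t))   ≈⟨ -‿distribʳ-* (sign s) _ ⟨
          - (sign s * (φ a t - φ b t))   ≈⟨ sign-not s _ ⟨
          sign (not s) * (φ a t - φ b t) ∎

    weights : Carrier → (Fin n → Carrier) → Functional (suc n)
    weights ℓ₀ Φ zero    = ℓ₀
    weights ℓ₀ Φ (suc v) = Φ v

    potential : Carrier → (Fin n → Carrier) → Fin n → Carrier
    potential ℓ₀ Φ v = if lookup B v then u v * ℓ₀ else Φ v

    weights-vertex : ∀ ℓ₀ Φ v → weights ℓ₀ Φ · φ v ≈ potential ℓ₀ Φ v
    weights-vertex ℓ₀ Φ v with lookup B v
    ... | true = begin
          sumF (λ t → weights ℓ₀ Φ t * (u v * δ zero t))   ≈⟨ sumF-cong (λ t → x∙yz≈y∙xz (weights ℓ₀ Φ t) (u v) (δ zero t)) ⟩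
          sumF (λ t → u v * (weights ℓ₀ Φ t * δ zero t))   ≈⟨ sumF-*ˡ (u v) (λ t → weights ℓ₀ Φ t * δ zero t) ⟩
          u v * sumF (λ t → weights ℓ₀ Φ t * δ zero t)     ≈⟨ *-congˡ (sumF-δ (weights ℓ₀ Φ) zero) ⟩
          u v * ℓ₀ ∎
    ... | false = sumF-δ (weights ℓ₀ Φ) (suc v)

    weights-e₀ : ∀ ℓ₀ Φ → weights ℓ₀ Φ · vec zero ≈ ℓ₀
    weights-e₀ ℓ₀ Φ = sumF-δ (weights ℓ₀ Φ) zero

    weights-edge : ∀ ℓ₀ Φ {f a b} → J f a b →
      ∃ λ s → weights ℓ₀ Φ · vec (suc f) ≈ sign s * (potential ℓ₀ Φ a - potential ℓ₀ Φ b)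
    weights-edge ℓ₀ Φ {f} {a} {b} f-joins with edge-vector f-joins
    ... | s , vec≈ = s , (begin
          L · vec (suc f)                  ≈⟨ ·-cong L vec≈ ⟩
          L · (λ t → sign s * (φ a t - φ b t))
                                           ≈⟨ ·-scaled-difference L (sign s) (φ a) (φ b) ⟩
          sign s * (L · φ a - L · φ b)     ≈⟨ *-congˡ (+-cong (weights-vertex ℓ₀ Φ a) (-‿cong (weights-vertex ℓ₀ Φ b))) ⟩
          sign s * (potential ℓ₀ Φ a - potential ℓ₀ Φ b) ∎)
        where
        L : Functional (suc n)
        L = weights ℓ₀ Φ

    flat-edge : ∀ ℓ₀ Φ {f a b} → J f a b → potential ℓ₀ Φ a ≈ potential ℓ₀ Φ b →
                weights ℓ₀ Φ · vec (suc f) ≈ 0#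
    flat-edge ℓ₀ Φ f-joins equal with weights-edge ℓ₀ Φ f-joins
    ... | s , value = ≈-trans value (≈-trans (*-congˡ (x≈y⇒x∙y⁻¹≈ε equal)) (zeroʳ _))

    steep-edge : ∀ ℓ₀ Φ {f a b} → J f a b → potential ℓ₀ Φ a ≉ potential ℓ₀ Φ b →
                 weights ℓ₀ Φ · vec (suc f) ≉ 0#
    steep-edge ℓ₀ Φ f-joins differ with weights-edge ℓ₀ Φ f-joins
    ... | s , value = λ zero-value →
          *-nonzero (sign≉0 s) (λ diff≈0 → differ (x∙y⁻¹≈ε⇒x≈y _ _ diff≈0)) (≈-trans (≈-sym value) zero-value)

    module AlongWalk (W : Walk) (ℓ₀ : Carrier) (Φ : Fin n → Carrier) (Θ : ℕ → Carrier)
                     (on-walk : ∀ j → j ℕ.≤ len W → potential ℓ₀ Φ (vtx W j) ≈ Θ j) where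
      Λ : Functional (suc n)
      Λ = weights ℓ₀ Φ

      flat-step : ∀ r → r ℕ.< len W → Θ r ≈ Θ (suc r) → Λ · vec (suc (edg W r)) ≈ 0#
      flat-step r r< equal = flat-edge ℓ₀ Φ (link W r r<)
        (≈-trans (on-walk r (ℕₚ.<⇒≤ r<)) (≈-trans equal (≈-sym (on-walk (suc r) r<))))

      steep-step : ∀ r → r ℕ.< len W → Θ r ≉ Θ (suc r) → Λ · vec (suc (edg W r)) ≉ 0#
      steep-step r r< differ = steep-edge ℓ₀ Φ (link W r r<)
        λ equal → differ (≈-trans (≈-sym (on-walk r (ℕₚ.<⇒≤ r<))) (≈-trans equal (on-walk (suc r) r<)))

      vanishes-off : ∀ f₁ f₂ → (∀ r → r ℕ.< len W → edg W r ≢ f₁ → edg W r ≢ f₂ → Θ r ≈ Θ (suc r)) →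
                     ∀ f → OnWalk W f → f ≢ f₁ → f ≢ f₂ → Λ · vec (suc f) ≈ 0#
      vanishes-off f₁ f₂ flat f (r , r< , ≡.refl) f≢f₁ f≢f₂ = flat-step r r< (flat r r< f≢f₁ f≢f₂)

    path-potential : ∀ (W : Walk) → IsPath W → ∀ ℓ₀ Θ →
      (∀ j → j ℕ.≤ len W → vtx W j ∈ B → Θ j ≈ u (vtx W j) * ℓ₀) →
      ∀ j → j ℕ.≤ len W → potential ℓ₀ (λ v → Θ (position (vtx W) (suc (len W)) v)) (vtx W j) ≈ Θ j
    path-potential W is-path ℓ₀ Θ boundary j j≤ with lookup B (vtx W j) in lj
    ... | true  = ≈-sym (boundary j j≤ (lookup⇒∈B lj))
    ... | false = ≈-reflexive (≡.cong Θ (position-of (vtx W) (suc (len W))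
                    (λ a b a< b< → is-path a b (ℕₚ.≤-pred a<) (ℕₚ.≤-pred b<)) j (s≤s j≤)))

    module _ (C : CycleWalk) (ℓ₀ : Carrier) (Θ : ℕ → Carrier)
             (boundary : ∀ j → j ℕ.< len (walk C) → vtx (walk C) j ∈ B → Θ j ≈ u (vtx (walk C) j) * ℓ₀) where
      private
        Φ : Fin n → Carrier
        Φ v = Θ (position (vtx (walk C)) (len (walk C)) v)

        before-end : ∀ j → j ℕ.< len (walk C) → potential ℓ₀ Φ (vtx (walk C) j) ≈ Θ j
        before-end j j< with lookup B (vtx (walk C) j) in lj
        ... | true  = ≈-sym (boundary j j< (lookup⇒∈B lj))
        ... | false = ≈-reflexive (≡.cong Θ (position-of (vtx (walk C)) (len (walk C)) (injective C) j j<))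

      cycle-potential : Θ (len (walk C)) ≈ Θ 0 → ∀ j → j ℕ.≤ len (walk C) → potential ℓ₀ Φ (vtx (walk C) j) ≈ Θ j
      cycle-potential closes j j≤ with ℕₚ.m≤n⇒m<n∨m≡n j≤
      ... | inj₁ j< = before-end j j<
      ... | inj₂ ≡.refl = begin
            potential ℓ₀ Φ (vtx (walk C) (len (walk C)))  ≡⟨ ≡.cong (potential ℓ₀ Φ) (closes-up C) ⟩
            potential ℓ₀ Φ (vtx (walk C) 0)             ≈⟨ before-end 0 (ℕₚ.≤-trans (s≤s z≤n) (length≥3 C)) ⟩
            Θ 0                                       ≈⟨ closes ⟨
            Θ (len (walk C))                            ∎

    module WalkCombination (W : Walk) where
      orientation : Fin (len W) → Bool
      orientation r = proj₁ (edge-vector (link W (toℕ r) (Finₚ.toℕ<n r)))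

      term : Fin (len W) → Fin m → Carrier
      term r f = if ⌊ edg W (toℕ r) ≟ f ⌋ then sign (orientation r) else 0#

      term-on : ∀ r → term r (edg W (toℕ r)) ≈ sign (orientation r)
      term-on r with edg W (toℕ r) ≟ edg W (toℕ r)
      ... | yes _ = ≈-refl
      ... | no ≢ = ⊥-elim (≢ ≡.refl)

      term-off : ∀ r f → edg W (toℕ r) ≢ f → term r f ≈ 0#
      term-off r f ≢f with edg W (toℕ r) ≟ f
      ... | yes ≡f = ⊥-elim (≢f ≡f)
      ... | no _ = ≈-refl

      coefficient : Fin m → Carrier
      coefficient f = sumF (λ r → term r f)

      coefficient-off : ∀ f → ¬ OnWalk W f → coefficient f ≈ 0#
      coefficient-off f f∉W = sumF-zero (λ r → term-off r f (λ e → f∉W (toℕ r , Finₚ.toℕ<n r , e)))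

      telescopes : ∀ t → sumF (λ f → coefficient f * vec (suc f) t) ≈ φ (vtx W 0) t - φ (vtx W (len W)) t
      telescopes t = begin
        sumF (λ f → coefficient f * vec (suc f) t)
          ≈⟨ sumF-cong (λ f → sumF-*ʳ (λ r → term r f) (vec (suc f) t)) ⟩
        sumF (λ f → sumF (λ r → term r f * vec (suc f) t))
          ≈⟨ sumF-comm (λ f r → term r f * vec (suc f) t) ⟩
        sumF (λ r → sumF (λ f → term r f * vec (suc f) t))
          ≈⟨ sumF-cong (λ r → sumF-single (λ f → term r f * vec (suc f) t) (edg W (toℕ r))
               (λ f f≢ → ≈-trans (*-congʳ (term-off r f (λ e → f≢ (≡.sym e)))) (zeroˡ _))) ⟩
        sumF (λ r → term r (edg W (toℕ r)) * vec (suc (edg W (toℕ r))) t)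
          ≈⟨ sumF-cong one-step ⟩
        sumF {len W} (λ r → φ (vtx W (toℕ r)) t - φ (vtx W (suc (toℕ r))) t)
          ≈⟨ sumF-telescope (len W) (λ j → φ (vtx W j) t) ⟩
        φ (vtx W 0) t - φ (vtx W (len W)) t ∎
        where
        one-step : ∀ r → term r (edg W (toℕ r)) * vec (suc (edg W (toℕ r))) t
                         ≈ φ (vtx W (toℕ r)) t - φ (vtx W (suc (toℕ r))) t
        one-step r = begin
          term r (edg W (toℕ r)) * vec (suc (edg W (toℕ r))) t
            ≈⟨ *-cong (term-on r) (proj₂ (edge-vector (link W (toℕ r) (Finₚ.toℕ<n r))) t) ⟩
          sign s * (sign s * difference)   ≈⟨ *-assoc _ _ _ ⟨
          (sign s * sign s) * difference   ≈⟨ *-congʳ (sign² s) ⟩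
          1# * difference                  ≈⟨ *-identityˡ _ ⟩
          difference ∎
          where
          s : Bool
          s = orientation r
          difference : Carrier
          difference = φ (vtx W (toℕ r)) t - φ (vtx W (suc (toℕ r))) t

      combination : Carrier → Fin (suc m) → Carrier
      combination x₀ zero    = x₀
      combination x₀ (suc f) = coefficient f

      combination-sum : ∀ x₀ t → sumF (λ i → combination x₀ i * vec i t)
                             ≈ x₀ * δ zero t + (φ (vtx W 0) t - φ (vtx W (len W)) t)
      combination-sum x₀ t = +-congˡ (telescopes t)

    walk-set : Bool → Walk → Subset (suc m)
    walk-set e₀? W = e₀? ∷ edgeSet W

    walk-set-edge : ∀ {e₀? W f} → suc f ∈ walk-set e₀? W → OnWalk W f
    walk-set-edge {W = W} (there f∈) = select-sound (onWalk? W) _ f∈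

    edge-walk-set : ∀ {e₀? W f} → OnWalk W f → suc f ∈ walk-set e₀? W
    edge-walk-set {W = W} f∈W = there (select-complete (onWalk? W) _ f∈W)

    between-isolates : ∀ e₀? (W : Walk) Φ flag s q → s ℕ.< len W → s ≢ q →
      (∀ j → j ℕ.≤ len W → potential 0# Φ (vtx W j) ≈ indicator (flag xor between s q j)) →
      Isolates (weights 0# Φ) (walk-set e₀? W ∖ suc (edg W q)) (suc (edg W s))
    between-isolates e₀? W Φ flag s q s< s≢q on-walk = vanishes , steep-step s s< jumps
      where
      open AlongWalk W 0# Φ (λ j → indicator (flag xor between s q j)) on-walk
      jumps : indicator (flag xor between s q s) ≉ indicator (flag xor between s q (suc s))
      jumps equal = between-jumps s q s≢q (xor-injective flag (indicator-injective equal))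
      vanishes : ∀ j → j ∈ walk-set e₀? W ∖ suc (edg W q) → j ≢ suc (edg W s) → Λ · vec j ≈ 0#
      vanishes zero    _  _ = weights-e₀ 0# Φ
      vanishes (suc f) j∈ j≢s with ∈-removal {C = walk-set e₀? W} {suc (edg W q)} j∈
      ... | f∈ , j≢q = vanishes-off (edg W s) (edg W q)
            (λ r _ r≢s r≢q → ≈-reflexive (≡.cong (λ b → indicator (flag xor b))
               (between-flat s q r (λ { ≡.refl → r≢s ≡.refl }) (λ { ≡.refl → r≢q ≡.refl }))))
            f (walk-set-edge {e₀?} {W} f∈) (λ { ≡.refl → j≢s ≡.refl }) (λ { ≡.refl → j≢q ≡.refl })

    module PathCircuit (Q : BoundaryPath B) where
      private
        W : Walk
        W = route Q
        N : ℕ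
        N = len W
        v₀ vₙ : Fin n
        v₀ = vtx W 0
        vₙ = vtx W N

      C : Subset (suc m)
      C = walk-set true W

      ends-differ : u v₀ ≉ u vₙ
      ends-differ equal = ℕₚ.<⇒≢ (route-nonempty Q) (route-path Q 0 N z≤n ℕₚ.≤-refl (u-injective _ _ (starts-in Q) (ends-in Q) equal))

      boundary-only-at-ends : ∀ j → j ℕ.≤ N → vtx W j ∈ B → j ≡ 0 ⊎ j ≡ N
      boundary-only-at-ends zero    _  _ = inj₁ ≡.refl
      boundary-only-at-ends (suc j) j≤ j∈B with ℕₚ.m≤n⇒m<n∨m≡n j≤
      ... | inj₁ j<N = ⊥-elim (inner-outside Q (suc j) (s≤s z≤n) j<N j∈B)
      ... | inj₂ j≡N = inj₂ j≡N

      open WalkCombination W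

      dependency : IsDependency (combination (u vₙ - u v₀))
      dependency t = ≈-trans (combination-sum _ t) (on-coordinate t)
        where
        on-coordinate : ∀ t → (u vₙ - u v₀) * δ zero t + (φ v₀ t - φ vₙ t) ≈ 0#
        on-coordinate t = begin
          (u vₙ - u v₀) * δ zero t + (φ v₀ t - φ vₙ t)
            ≈⟨ +-congˡ (+-cong (φ-boundary t (starts-in Q)) (-‿cong (φ-boundary t (ends-in Q)))) ⟩
          (u vₙ - u v₀) * δ zero t + (u v₀ * δ zero t - u vₙ * δ zero t)
            ≈⟨ +-congʳ (distribʳ (δ zero t) (u vₙ) (- u v₀)) ⟩
          (u vₙ * δ zero t + - u v₀ * δ zero t) + (u v₀ * δ zero t - u vₙ * δ zero t)
            ≈⟨ +-congʳ (+-congˡ (-‿distribˡ-* (u v₀) (δ zero t))) ⟨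
          (u vₙ * δ zero t - u v₀ * δ zero t) + (u v₀ * δ zero t - u vₙ * δ zero t)
            ≈⟨ telescope (u vₙ * δ zero t) (u v₀ * δ zero t) (u vₙ * δ zero t) ⟩
          u vₙ * δ zero t - u vₙ * δ zero t
            ≈⟨ -‿inverseʳ _ ⟩
          0# ∎

      dependent : ¬ LinIndep vec C
      dependent independent =
        ends-differ (≈-sym (x∙y⁻¹≈ε⇒x≈y _ _ (independent _ outside-C dependency zero)))
        where
        outside-C : ∀ i → i ∉ C → combination (u vₙ - u v₀) i ≈ 0#
        outside-C zero    i∉C = ⊥-elim (i∉C here)
        outside-C (suc f) i∉C = coefficient-off f (λ f∈W → i∉C (edge-walk-set f∈W))

      -- The potential (ℓ₀ = 1) equal to u(v₀) up to position p and to
      -- u(vₙ) after it isolates e₀ and the edge at p from the other edges.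
      module Step (p : ℕ) (p< : p ℕ.< N) where
        Θ : ℕ → Carrier
        Θ j = if after p j then u vₙ else u v₀

        boundary : ∀ j → j ℕ.≤ N → vtx W j ∈ B → Θ j ≈ u (vtx W j) * 1#
        boundary j j≤ j∈B with boundary-only-at-ends j j≤ j∈B
        ... | inj₁ ≡.refl = ≈-sym (*-identityʳ _)
        ... | inj₂ ≡.refl rewrite after-past p N p< = ≈-sym (*-identityʳ _)

        open AlongWalk W 1# (λ v → Θ (position (vtx W) (suc N) v)) Θ
                       (path-potential W (route-path Q) 1# Θ boundary) public

        vanishes : ∀ f → OnWalk W f → f ≢ edg W p → Λ · vec (suc f) ≈ 0#
        vanishes f f∈W f≢p = vanishes-off (edg W p) (edg W p)
          (λ r _ r≢p _ → ≈-reflexive (≡.cong (λ b → if b then u vₙ else u v₀)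
             (after-flat p r (λ { ≡.refl → r≢p ≡.refl })))) f f∈W f≢p f≢p

        steep : Λ · vec (suc (edg W p)) ≉ 0#
        steep = steep-step p p< λ equal →
          ends-differ (≈-trans (≈-reflexive (≡.cong (λ b → if b then u vₙ else u v₀) (≡.sym (after-at p))))
                      (≈-trans equal (≈-reflexive (≡.cong (λ b → if b then u vₙ else u v₀) (after-next p)))))

        e₀-nonzero : Λ · vec zero ≉ 0#
        e₀-nonzero e₀≈0 = 1≉0 (≈-trans (≈-sym (weights-e₀ 1# _)) e₀≈0)

      between-on-path : ∀ s q → s ℕ.< N → q ℕ.< N → ∀ j → j ℕ.≤ N →
        potential 0# (λ v → indicator (between s q (position (vtx W) (suc N) v))) (vtx W j)
          ≈ indicator (false xor between s q j)
      between-on-path s q s< q< = path-potential W (route-path Q) 0# (λ j → indicator (between s q j)) boundary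
        where
        boundary : ∀ j → j ℕ.≤ N → vtx W j ∈ B → indicator (between s q j) ≈ u (vtx W j) * 0#
        boundary j j≤ j∈B with boundary-only-at-ends j j≤ j∈B
        ... | inj₁ ≡.refl = ≈-sym (zeroʳ _)
        ... | inj₂ ≡.refl rewrite between-past s q N s< q< = ≈-sym (zeroʳ _)

      -- Any two distinct elements are separated by a Step or a between potential.
      isolate : ∀ d i → d ∈ C → i ∈ C → i ≢ d → ∃ λ Λ → Isolates Λ (C ∖ d) i
      isolate zero zero _ _ i≢d = ⊥-elim (i≢d ≡.refl)
      isolate zero (suc f) _ i∈C _ with walk-set-edge {true} {W} i∈C
      ... | p , p< , ≡.refl = Step.Λ p p< , vanishes-except-p , Step.steep p p<
        where
        vanishes-except-p : ∀ j → j ∈ C ∖ zero → j ≢ suc (edg W p) → Step.Λ p p< · vec j ≈ 0#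
        vanishes-except-p j j∈ j≢p with ∈-removal {C = C} {zero} j∈
        vanishes-except-p zero    _ _   | _ , j≢0 = ⊥-elim (j≢0 ≡.refl)
        vanishes-except-p (suc g) _ j≢p | g∈C , _ =
          Step.vanishes p p< g (walk-set-edge {true} {W} g∈C) (λ { ≡.refl → j≢p ≡.refl })
      isolate (suc g) zero d∈C _ _ with walk-set-edge {true} {W} d∈C
      ... | q , q< , ≡.refl = Step.Λ q q< , vanishes-except-e₀ , Step.e₀-nonzero q q<
        where
        vanishes-except-e₀ : ∀ j → j ∈ C ∖ suc (edg W q) → j ≢ zero → Step.Λ q q< · vec j ≈ 0#
        vanishes-except-e₀ zero    _  j≢0 = ⊥-elim (j≢0 ≡.refl)
        vanishes-except-e₀ (suc h) j∈ _ with ∈-removal {C = C} {suc (edg W q)} j∈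
        ... | h∈C , j≢q = Step.vanishes q q< h (walk-set-edge {true} {W} h∈C) (λ { ≡.refl → j≢q ≡.refl })
      isolate (suc g) (suc f) d∈C i∈C i≢d
        with walk-set-edge {true} {W} d∈C | walk-set-edge {true} {W} i∈C
      ... | q , q< , ≡.refl | s , s< , ≡.refl =
            weights 0# Φ , between-isolates true W Φ false s q s< (λ { ≡.refl → i≢d ≡.refl })
                             (between-on-path s q s< q<)
        where
        Φ : Fin n → Carrier
        Φ v = indicator (between s q (position (vtx W) (suc N) v))

      circuit : LinCircuit vec C
      circuit = dependent , proper-subsets-independent C isolate

    module CycleCircuit (Cy : CycleWalk) where
      private
        W : Walk
        W = walk Cy
        N : ℕ
        N = len W
        0<N : 0 ℕ.< N
        0<N = ℕₚ.≤-trans (s≤s z≤n) (length≥3 Cy)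

      D : Subset (suc m)
      D = walk-set false W

      open WalkCombination W

      -- The signed edges of a closed walk sum to 0 ...
      dependency : IsDependency (combination 0#)
      dependency t = begin
        sumF (λ i → combination 0# i * vec i t)              ≈⟨ combination-sum 0# t ⟩
        0# * δ zero t + (φ (vtx W 0) t - φ (vtx W N) t)  ≈⟨ +-cong (zeroˡ _) (+-congˡ (-‿cong closes)) ⟩
        0# + (φ (vtx W 0) t - φ (vtx W 0) t)             ≈⟨ +-congˡ (-‿inverseʳ _) ⟩
        0# + 0#                                          ≈⟨ +-identityˡ 0# ⟩
        0# ∎
        where
        closes : φ (vtx W N) t ≈ φ (vtx W 0) t
        closes = ≈-reflexive (≡.cong (λ v → φ v t) (closes-up Cy))

      -- ... and the coefficient ±1 of its first edge is nonzero, because the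
      -- edges of a cycle are pairwise distinct.
      first-coefficient : coefficient (edg W 0) ≉ 0#
      first-coefficient coefficient≈0 = sign≉0 (orientation r₀) (begin
        sign (orientation r₀)   ≈⟨ ≡.subst (λ k → term r₀ (edg W k) ≈ sign (orientation r₀))
                                       (Finₚ.toℕ-fromℕ< 0<N) (term-on r₀) ⟨
        term r₀ (edg W 0)       ≈⟨ sumF-single (λ r → term r (edg W 0)) r₀ other-positions ⟨
        coefficient (edg W 0)   ≈⟨ coefficient≈0 ⟩
        0# ∎)
        where
        r₀ : Fin N
        r₀ = fromℕ< 0<N
        other-positions : ∀ r → r ≢ r₀ → term r (edg W 0) ≈ 0#
        other-positions r r≢r₀ = term-off r (edg W 0) λ same-edge → r≢r₀ (Finₚ.toℕ-injective
          (≡.trans (edges-distinct Cy (toℕ r) 0 (Finₚ.toℕ<n r) 0<N same-edge) (≡.sym (Finₚ.toℕ-fromℕ< 0<N))))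

      dependent : ¬ LinIndep vec D
      dependent independent = first-coefficient (independent (combination 0#) outside-D dependency (suc (edg W 0)))
        where
        outside-D : ∀ i → i ∉ D → combination 0# i ≈ 0#
        outside-D zero    _   = ≈-refl
        outside-D (suc f) i∉D = coefficient-off f (λ f∈W → i∉D (edge-walk-set f∈W))

      -- ... and a circuit when the cycle meets the boundary at most once:
      -- flipping a between-profile so that it vanishes at that boundary node
      -- gives potentials separating any two edges.
      module _ (one-boundary : ∀ j j′ → j ℕ.< N → j′ ℕ.< N → vtx W j ∈ B → vtx W j′ ∈ B → j ≡ j′) where
        boundary-flag : ∀ (β : ℕ → Bool) → ∃ λ flag → ∀ j → j ℕ.< N → vtx W j ∈ B → flag xor β j ≡ false
        boundary-flag β with least (λ p → vtx W p Subsetₚ.∈? B) N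
        ... | inj₁ (p , p< , p∈B , _) = β p , λ j j< j∈B →
              ≡.subst (λ k → β p xor β k ≡ false) (one-boundary p j p< j< p∈B j∈B) (Boolₚ.xor-same (β p))
        ... | inj₂ none = false , λ j j< j∈B → ⊥-elim (none j j< j∈B)

        isolate : ∀ d i → d ∈ D → i ∈ D → i ≢ d → ∃ λ Λ → Isolates Λ (D ∖ d) i
        isolate (suc g) (suc f) d∈D i∈D i≢d
          with walk-set-edge {false} {W} d∈D | walk-set-edge {false} {W} i∈D
        ... | q , q< , ≡.refl | s , s< , ≡.refl =
              weights 0# Φ , between-isolates false W Φ flag s q s< (λ { ≡.refl → i≢d ≡.refl })
                               (cycle-potential Cy 0# Θ boundary closes)
          where
          flag : Bool
          flag = proj₁ (boundary-flag (between s q))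
          Θ : ℕ → Carrier
          Θ j = indicator (flag xor between s q j)
          Φ : Fin n → Carrier
          Φ v = Θ (position (vtx W) N v)
          boundary : ∀ j → j ℕ.< N → vtx W j ∈ B → Θ j ≈ u (vtx W j) * 0#
          boundary j j< j∈B rewrite proj₂ (boundary-flag (between s q)) j j< j∈B = ≈-sym (zeroʳ _)
          closes : Θ N ≈ Θ 0
          closes = ≈-reflexive (≡.cong (λ b → indicator (flag xor b)) (between-past s q N s< q<))

        circuit : LinCircuit vec D
        circuit = dependent , proper-subsets-independent D isolate

    -- Potentials that are constant on the components of a set F of edges,
    -- hence vanish on every edge of F.
    module ComponentPotentials (F : Subset m) where
      open Reach F

      module _ (ℓ₀ : Carrier) (g : Subset n → Carrier)
               (boundary : ∀ b → b ∈ B → g (Rch b) ≈ u b * ℓ₀) where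
        component-potential : ∀ v → potential ℓ₀ (λ w → g (Rch w)) v ≈ g (Rch v)
        component-potential v with lookup B v in lv
        ... | true  = ≈-sym (boundary v (lookup⇒∈B lv))
        ... | false = ≈-refl

        vanishes-on-F : ∀ f → f ∈ F → weights ℓ₀ (λ w → g (Rch w)) · vec (suc f) ≈ 0#
        vanishes-on-F f f∈F = flat-edge ℓ₀ Φ (inj₁ ≡.refl) (begin
          potential ℓ₀ Φ (proj₁ (ends f))  ≈⟨ component-potential _ ⟩
          g (Rch (proj₁ (ends f)))         ≡⟨ ≡.cong g (Rch-adj f f∈F) ⟩
          g (Rch (proj₂ (ends f)))         ≈⟨ component-potential _ ⟨
          potential ℓ₀ Φ (proj₂ (ends f))  ∎)
          where
          Φ : Fin n → Carrier
          Φ w = g (Rch w)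

      boundary-value : Subset n → Carrier
      boundary-value S with Finₚ.any? (λ w → (w Subsetₚ.∈? B) ×-dec (w Subsetₚ.∈? S))
      ... | yes (w , _) = u w
      ... | no _ = 0#

      boundary-value-spec : ∀ S → (∃ λ w → w ∈ B × w ∈ S × boundary-value S ≡ u w)
                                ⊎ (∀ w → w ∈ B → w ∉ S)
      boundary-value-spec S with Finₚ.any? (λ w → (w Subsetₚ.∈? B) ×-dec (w Subsetₚ.∈? S))
      ... | yes (w , w∈B , w∈S) = inj₁ (w , w∈B , w∈S , ≡.refl)
      ... | no none = inj₂ (λ w w∈B w∈S → none (w , w∈B , w∈S))

      module _ (separated : ∀ b b′ → b ∈ B → b′ ∈ B → b ≢ b′ → b′ ∉ Rch b) where
        boundary-value-at : ∀ b → b ∈ B → boundary-value (Rch b) ≈ u b * 1#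
        boundary-value-at b b∈B with boundary-value-spec (Rch b)
        ... | inj₂ none = ⊥-elim (none b b∈B (Rch-self b))
        ... | inj₁ (w , w∈B , w∈Rch , value≡) with w ≟ b
        ...   | yes ≡.refl = ≈-trans (≈-reflexive value≡) (≈-sym (*-identityʳ _))
        ...   | no w≢b = ⊥-elim (separated b w b∈B w∈B (λ e → w≢b (≡.sym e)) w∈Rch)

      module _ (r : Fin n) (no-boundary : ∀ w → w ∈ B → w ∉ Rch r) where
        component-indicator : Subset n → Carrier
        component-indicator S = indicator ⌊ S ≟S Rch r ⌋

        component-indicator-at : ∀ b → b ∈ B → component-indicator (Rch b) ≈ u b * 0#
        component-indicator-at b b∈B with Rch b ≟S Rch r
        ... | yes same = ⊥-elim (no-boundary b b∈B (≡.subst (b ∈_) same (Rch-self b)))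
        ... | no _ = ≈-sym (zeroʳ _)

        component-indicator-separates : ∀ v → v ∉ Rch r →
          component-indicator (Rch v) ≉ component-indicator (Rch r)
        component-indicator-separates v v∉ with Rch v ≟S Rch r | Rch r ≟S Rch r
        ... | yes same | _ = ⊥-elim (v∉ (≡.subst (v ∈_) same (Rch-self v)))
        ... | no _ | yes _ = λ 0≈1 → 1≉0 (≈-sym 0≈1)
        ... | no _ | no differ = ⊥-elim (differ ≡.refl)

-- The two directions of Lemma 4.9 for a network N = (Γ, B) with boundary values u.
module Network (R : CommutativeRing 0ℓ 0ℓ) (isField : IsField R)
               {n m : ℕ} (ends : Fin m → Fin n × Fin n) (B : Subset n) (network : IsNetwork ends B)
               (u : Fin n → CommutativeRing.Carrier R) (u-injective : Linear.InjectiveOn R B u)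
               (σ : Permutation m m) where
  open LinearAlgebra
  open Graphs
  open FiniteSets
  open Potentials
  open import Data.Nat as ℕ using (ℕ; zero; suc; z≤n; s≤s)
  import Data.Nat.Properties as ℕₚ
  open import Data.Fin using (Fin; zero; suc; toℕ)
  import Data.Fin.Properties as Finₚ
  open import Data.Fin.Subset using (Subset; _∈_; _∉_; _⊆_; inside; outside) renaming (_-_ to _∖_)
  import Data.Fin.Subset.Properties as Subsetₚ
  open import Data.Vec using (_∷_; here; there; tail)
  open import Data.Bool using (Bool; true; false)
  open import Data.Product using (_×_; _,_; proj₁; proj₂; ∃)
  open import Data.Sum using (inj₁; inj₂)
  open import Data.Empty using (⊥; ⊥-elim)
  open import Relation.Nullary using (¬_; yes; no)
  open import Relation.Binary.PropositionalEquality as ≡ using (_≡_; _≢_)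

  -- A network has an edge: its two distinct boundary nodes are joined by a
  -- walk, which cannot be empty.
  anyEdge : Fin m
  anyEdge with proj₁ (proj₂ (proj₂ (proj₂ network)))
  ... | b , b′ , b≢b′ , _ with proj₁ (proj₂ network) b b′
  ...   | zero  , _  , start , end , _    = ⊥-elim (b≢b′ (≡.trans (≡.sym start) end))
  ...   | suc _ , _  , _     , _   , steps = proj₁ (steps zero)

  open FieldFacts R isField
  open Walks ends anyEdge
  open Dirichlet R isField ends B network u u-injective anyEdge
  open Linear R using (LinIndep; LinCircuit; DirichletCircuit)

  DC : Subset (suc m) → Set
  DC = DirichletCircuit ends B u

  module _ (y : Bool) (Yₑ : Subset m) where
    Y : Subset (suc m)
    Y = y ∷ Yₑ

    -- Forward direction: circuits built from crossings and from broken
    -- circuits of M(Γ) would give broken circuits of M(N).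
    module Forward (no-broken : ¬ ContainsBrokenCircuit (rank0 σ) DC Y) where

      -- {e₀} ∪ E(Q) is a circuit with minimum e₀.
      no-boundary-path : (Q : BoundaryPath B) → (∀ f → OnWalk (route Q) f → f ∈ Yₑ) → ⊥
      no-boundary-path Q Q⊆Y = no-broken
        (PathCircuit.C Q , PathCircuit.circuit Q , zero , here , (λ _ _ → z≤n) , rest-in-Y)
        where
        rest-in-Y : ∀ d → d ∈ PathCircuit.C Q → d ≢ zero → d ∈ Y
        rest-in-Y zero    _  d≢0 = ⊥-elim (d≢0 ≡.refl)
        rest-in-Y (suc f) d∈ _   = there (Q⊆Y f (walk-set-edge {true} {route Q} d∈))

      -- A crossing contains a boundary-to-boundary path with interior inner vertices.
      no-crossing : ¬ ContainsCrossing ends B Yₑ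
      no-crossing (P , ((_ , p , P-edges , i , j , i≢j , vi∈B , vj∈B) , _) , P⊆Y)
        with boundary-path-between {B} (PathAsWalk.pW p) (PathAsWalk.pW-path p) (toℕ i) (toℕ j)
               (Finₚ.toℕ≤pred[n] i) (Finₚ.toℕ≤pred[n] j) (λ same → i≢j (Finₚ.toℕ-injective same))
               (≡.subst (_∈ B) (≡.sym (PathAsWalk.pv-at p i)) vi∈B)
               (≡.subst (_∈ B) (≡.sym (PathAsWalk.pv-at p j)) vj∈B)
      ... | Q , Q⊆p = no-boundary-path Q λ f f∈Q →
            P⊆Y (proj₂ (P-edges f) (PathAsWalk.pE⇒ p f (edges-from-on-walk {route Q} {PathAsWalk.pW p} Q⊆p f∈Q)))

      -- A cycle whose edges other than its minimum (at position l) lie in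
      -- Yₑ: if it meets the boundary at most once, its edge set is a
      -- circuit of M(N) with the same minimum; otherwise, rotated to start
      -- after l, it contains a boundary-to-boundary path avoiding l.
      no-broken-cycle : ∀ (Cy : CycleWalk) l → l ℕ.< len (walk Cy) →
        (∀ f → OnWalk (walk Cy) f → rankE σ (edg (walk Cy) l) ℕ.≤ rankE σ f) →
        (∀ f → OnWalk (walk Cy) f → f ≢ edg (walk Cy) l → f ∈ Yₑ) → ⊥
      no-broken-cycle Cy l l< e-min rest with two-or-at-most-one (λ p → vtx (walk Cy) p Subsetₚ.∈? B) (len (walk Cy))
      ... | inj₂ one-boundary =
            no-broken (CycleCircuit.D Cy , CycleCircuit.circuit Cy one-boundary ,
                       suc (edg W l) , edge-walk-set {false} {W} (l , l< , ≡.refl) , minimal , rest-in-Y)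
        where
        W : Walk
        W = walk Cy
        minimal : ∀ d → d ∈ CycleCircuit.D Cy → rank0 σ (suc (edg W l)) ℕ.≤ rank0 σ d
        minimal (suc f) d∈ = s≤s (e-min f (walk-set-edge {false} {W} d∈))
        rest-in-Y : ∀ d → d ∈ CycleCircuit.D Cy → d ≢ suc (edg W l) → d ∈ Y
        rest-in-Y (suc f) d∈ d≢e = there (rest f (walk-set-edge {false} {W} d∈) (λ { ≡.refl → d≢e ≡.refl }))
      ... | inj₁ (p₁ , p₂ , p₁< , p₂< , p₁≢p₂ , p₁∈B , p₂∈B)
        with Rotation.boundary-path-avoiding Cy l l< p₁ p₂ p₁< p₂< p₁≢p₂ p₁∈B p₂∈B
      ...   | Q , Q-edges = no-boundary-path Q λ f f∈Q → rest f (proj₁ (Q-edges f f∈Q)) (proj₂ (Q-edges f f∈Q))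

      -- A broken circuit D ∖ e of M(Γ) is a cycle as above.
      no-graphic-broken : InBC (rankE σ) (GraphicCircuit ends) Yₑ
      no-graphic-broken (D , (k , cycle , D-edges) , e , e∈D , e-min , rest)
        with CycleAsWalk.fE⇐ cycle e (proj₁ (D-edges e) e∈D)
      ... | l , l< , ≡.refl = no-broken-cycle (CycleAsWalk.as-CycleWalk cycle) l l<
            (λ f f∈ → e-min f (on-D f f∈)) (λ f f∈ f≢e → rest f (on-D f f∈) f≢e)
        where
        on-D : ∀ f → OnWalk (CycleAsWalk.fW cycle) f → f ∈ D
        on-D f f∈ = proj₂ (D-edges f) (CycleAsWalk.fE⇒ cycle f f∈)

    -- Backward direction: without crossings and broken circuits of M(Γ) in
    -- Yₑ, every circuit of M(N) whose non-minimal elements lie in Y has an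
    -- element isolated by a potential, which circuits cannot have.
    module Backward (no-graphic : InBC (rankE σ) (GraphicCircuit ends) Yₑ)
                    (no-crossing : ¬ ContainsCrossing ends B Yₑ) where

      -- No path inside Yₑ meets two boundary nodes: it would contain a crossing.
      no-boundary-path-set : ∀ S → PathSetMeetingTwo ends B S → S ⊆ Yₑ → ⊥
      no-boundary-path-set S meets S⊆Y = minimal-subset (PathSetMeetingTwo ends B) S meets
        λ { (P , minimal , P⊆S) → no-crossing (P , minimal , (λ x∈P → S⊆Y (P⊆S x∈P))) }

      -- So the components of any F ⊆ Yₑ contain at most one boundary node:
      -- a path in F joining two of them meets two boundary nodes.
      separated : ∀ F → F ⊆ Yₑ → ∀ b b′ → b ∈ B → b′ ∈ B → b ≢ b′ → b′ ∉ Reach.Rch F b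
      separated F F⊆Y b b′ b∈B b′∈B b≢b′ b′∈Rch with Reach.Rch-path F b′∈Rch
      ... | P , is-path , start , end , P⊆F =
            no-boundary-path-set (edgeSet P)
              (path-set-meeting-two P is-path nonempty (≡.subst (_∈ B) (≡.sym start) b′∈B)
                                                       (≡.subst (_∈ B) (≡.sym end) b∈B))
              P⊆Y
        where
        nonempty : 0 ℕ.< len P
        nonempty = ℕₚ.n≢0⇒n>0 λ len≡0 →
          b≢b′ (≡.trans (≡.sym end) (≡.trans (≡.cong (vtx P) len≡0) start))
        P⊆Y : edgeSet P ⊆ Yₑ
        P⊆Y {f} f∈P with select-sound (onWalk? P) f f∈P
        ... | t , t< , ≡.refl = F⊆Y (P⊆F t t<)

      -- A circuit containing e₀ with its other elements in Y: the potential
      -- giving each component of C ∖ e₀ its boundary value isolates e₀.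
      not-through-e₀ : ∀ C → LinCircuit vec C → zero ∈ C → (∀ d → d ∈ C → d ≢ zero → d ∈ Y) → ⊥
      not-through-e₀ (_ ∷ Cₑ) circuit e₀∈C rest =
        circuit-not-isolable circuit e₀∈C (weights 1# (λ v → boundary-value (Rch v))) (vanishes , e₀-nonzero)
        where
        Cₑ⊆Y : Cₑ ⊆ Yₑ
        Cₑ⊆Y {f} f∈ = Subsetₚ.drop-there (rest (suc f) (there f∈) (λ ()))
        open ComponentPotentials Cₑ
        open Reach Cₑ
        vanishes : ∀ j → j ∈ _ ∷ Cₑ → j ≢ zero → weights 1# (λ v → boundary-value (Rch v)) · vec j ≈ 0#
        vanishes zero    _          j≢0 = ⊥-elim (j≢0 ≡.refl)
        vanishes (suc f) (there f∈) _   =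
          vanishes-on-F 1# boundary-value (boundary-value-at (separated Cₑ Cₑ⊆Y)) f f∈
        e₀-nonzero : weights 1# (λ v → boundary-value (Rch v)) · vec zero ≉ 0#
        e₀-nonzero e₀≈0 = 1≉0 (≈-trans (≈-sym (weights-e₀ 1# _)) e₀≈0)

      module MinimumEdge (Cₑ : Subset m) (circuit : LinCircuit vec (outside ∷ Cₑ))
                         (e : Fin m) (e∈C : e ∈ Cₑ) (e-min : ∀ f → f ∈ Cₑ → rankE σ e ℕ.≤ rankE σ f)
                         (rest : ∀ f → f ∈ Cₑ → f ≢ e → f ∈ Yₑ) where
        F : Subset m
        F = Cₑ ∖ e

        F⊆Y : F ⊆ Yₑ
        F⊆Y f∈F = rest _ (proj₁ (∈-removal f∈F)) (proj₂ (∈-removal f∈F))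

        open Reach F
        open ComponentPotentials F

        a a′ : Fin n
        a = proj₁ (ends e)
        a′ = proj₂ (ends e)

        module PathInF (W : Walk) (is-path : IsPath W) (start : vtx W 0 ≡ a) (end : vtx W (len W) ≡ a′)
                       (W⊆F : ∀ t → t ℕ.< len W → edg W t ∈ F) where
          closes : J e (vtx W (len W)) (vtx W 0)
          closes = inj₂ (≡.cong₂ _,_ (≡.sym start) (≡.sym end))

          D : Subset m
          D = closed-edge-set W e

          D⊆Cₑ : D ⊆ Cₑ
          D⊆Cₑ {f} f∈D with select-sound _ f f∈D
          ... | inj₁ (r , r< , ≡.refl) = proj₁ (∈-removal (W⊆F r r<))
          ... | inj₂ ≡.refl = e∈C

          -- If D = Cₑ, then D ∖ e is a broken circuit of M(Γ) in
          -- Yₑ; otherwise E(D) is dependent but lies in a proper subset of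
          -- the circuit.
          module _ (k : ℕ) (len≡ : len W ≡ suc (suc k)) where
            cycle : CycleWalk
            cycle = CycleAsWalk.as-CycleWalk (close-path W is-path k len≡ e closes)

            cycle⊆D : CycleCircuit.D cycle ⊆ outside ∷ D
            cycle⊆D (there f∈) = there (proj₂ (proj₂ (proj₂ (closed-graphic-circuit W is-path k len≡ e closes)) _)
              (CycleAsWalk.fE⇒ (close-path W is-path k len≡ e closes) _ (select-sound (onWalk? _) _ f∈)))

            long : ⊥
            long with D ≟S Cₑ
            ... | yes D≡Cₑ = no-graphic (D , closed-graphic-circuit W is-path k len≡ e closes ,
                                         e , select-complete _ e (inj₂ ≡.refl) ,
                                         (λ f f∈D → e-min f (in-Cₑ f∈D)) , (λ f f∈D → rest f (in-Cₑ f∈D)))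
              where
              in-Cₑ : ∀ {f} → f ∈ D → f ∈ Cₑ
              in-Cₑ {f} = ≡.subst (f ∈_) D≡Cₑ
            ... | no D≢Cₑ = CycleCircuit.dependent cycle (independent-subset cycle⊆D
                              (proj₂ circuit (outside ∷ D) D⊆C (λ same → D≢Cₑ (≡.cong tail same))))
              where
              D⊆C : outside ∷ D ⊆ outside ∷ Cₑ
              D⊆C (there f∈D) = there (D⊆Cₑ f∈D)

          -- Shorter paths contradict the absence of loops and multiple edges.
          by-length : ∀ L → len W ≡ L → ⊥
          by-length zero len≡0 = proj₁ (proj₁ network) e
            (≡.trans (≡.sym start) (≡.trans (≡.cong (vtx W) (≡.sym len≡0)) end))
          by-length (suc zero) len≡1 = proj₂ (∈-removal (W⊆F 0 0<)) (proj₂ (proj₁ network) (edg W 0) e a a′ f-joins (inj₁ ≡.refl))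
            where
            0< : 0 ℕ.< len W
            0< = ≡.subst (0 ℕ.<_) (≡.sym len≡1) (s≤s z≤n)
            f-joins : J (edg W 0) a a′
            f-joins = subst₃ J ≡.refl start (≡.trans (≡.cong (vtx W) (≡.sym len≡1)) end) (link W 0 0<)
          by-length (suc (suc k)) len≡ = long k len≡

          impossible : ⊥
          impossible = by-length (len W) ≡.refl

        ends-disconnected : a ∉ Rch a′
        ends-disconnected a∈Rch with Rch-path a∈Rch
        ... | P , is-path , start , end , P⊆F = PathInF.impossible P is-path start end P⊆F

        -- A potential constant on the components of F which differs at a and
        -- a′ vanishes on F but not on e.
        Separating : Set
        Separating = ∃ λ Λ → (∀ f → f ∈ F → Λ · vec (suc f) ≈ 0#) × Λ · vec (suc e) ≉ 0#

        separating-by : ∀ ℓ₀ g (boundary : ∀ b → b ∈ B → g (Rch b) ≈ u b * ℓ₀) →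
                        g (Rch a) ≉ g (Rch a′) → Separating
        separating-by ℓ₀ g boundary differ =
          weights ℓ₀ (λ v → g (Rch v)) , vanishes-on-F ℓ₀ g boundary ,
          steep-edge ℓ₀ _ (inj₁ ≡.refl) λ equal →
            differ (≈-trans (≈-sym (component-potential ℓ₀ g boundary a))
                            (≈-trans equal (component-potential ℓ₀ g boundary a′)))

        -- If a component of a or a′ has no boundary node, use its indicator;
        -- otherwise the boundary values, which differ as u is injective.
        separating : Separating
        separating with boundary-value-spec (Rch a′)
        ... | inj₂ a′-free = separating-by 0# (component-indicator a′ a′-free)
                               (component-indicator-at a′ a′-free)
                               (component-indicator-separates a′ a′-free a ends-disconnected)
        ... | inj₁ (w′ , w′∈B , w′∈ , value′) with boundary-value-spec (Rch a)
        ...   | inj₂ a-free = separating-by 0# (component-indicator a a-free)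
                                (component-indicator-at a a-free)
                                (λ equal → component-indicator-separates a a-free a′ a′∉ (≈-sym equal))
          where
          a′∉ : a′ ∉ Rch a
          a′∉ a′∈ = ends-disconnected (≡.subst (a ∈_) (≡.sym (Rch-eq a′∈)) (Rch-self a))
        ...   | inj₁ (w , w∈B , w∈ , value) = separating-by 1# boundary-value
                  (boundary-value-at (separated F F⊆Y)) differ
          where
          differ : boundary-value (Rch a) ≉ boundary-value (Rch a′)
          differ equal = ends-disconnected (≡.subst (a ∈_) same-component (Rch-self a))
            where
            w≡w′ : w ≡ w′
            w≡w′ = u-injective w w′ w∈B w′∈B
                     (≈-trans (≈-sym (≈-reflexive value)) (≈-trans equal (≈-reflexive value′)))
            same-component : Rch a ≡ Rch a′
            same-component = ≡.trans (≡.sym (Rch-eq w∈)) (≡.trans (≡.cong Rch w≡w′) (Rch-eq w′∈))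

        contradiction : ⊥
        contradiction with separating
        ... | Λ , vanishes , steep = circuit-not-isolable circuit (there e∈C) Λ (others , steep)
          where
          others : ∀ j → j ∈ outside ∷ Cₑ → j ≢ suc e → Λ · vec j ≈ 0#
          others (suc f) (there f∈) j≢e = vanishes f (Subsetₚ.x∈p∧x≢y⇒x∈p-y f∈ (λ { ≡.refl → j≢e ≡.refl }))

      no-broken : ¬ ContainsBrokenCircuit (rank0 σ) DC Y
      no-broken (C , circuit , zero , e₀∈C , _ , rest) = not-through-e₀ C circuit e₀∈C rest
      no-broken (inside ∷ Cₑ , _ , suc e , _ , e-min , _) with e-min zero here
      ... | ()
      no-broken (outside ∷ Cₑ , circuit , suc e , there e∈C , e-min , rest) =
        MinimumEdge.contradiction Cₑ circuit e e∈C
          (λ f f∈ → ℕₚ.≤-pred (e-min (suc f) (there f∈)))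
          (λ f f∈ f≢e → Subsetₚ.drop-there (rest (suc f) (there f∈) (λ same → f≢e (Finₚ.suc-injective same))))

lemma4p9 : (R : CommutativeRing 0ℓ 0ℓ) → IsField R →
    {n m : ℕ} (ends : Fin m → Fin n × Fin n) (B : Subset n) →
    IsNetwork ends B →
    (u : Fin n → CommutativeRing.Carrier R) → Linear.InjectiveOn R B u →
    (σ : Permutation m m) → (Y : Subset (suc m)) →
    InReducedBC (rank0 σ) (Linear.DirichletCircuit R ends B u) zero Y
      ⇔ (zero ∉ Y
         × InBC (rankE σ) (GraphicCircuit ends) (tail Y)
         × ¬ ContainsCrossing ends B (tail Y))
lemma4p9 R isField ends B network u u-injective σ (y ∷ Yₑ) = mk⇔
  (λ (no-broken , e₀∉Y) → e₀∉Y , Forward.no-graphic-broken y Yₑ no-broken , Forward.no-crossing y Yₑ no-broken)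
  (λ (e₀∉Y , no-graphic , no-crossing) → Backward.no-broken y Yₑ no-graphic no-crossing , e₀∉Y)
  where open Network R isField ends B network u u-injective σ
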